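{- For every integer $r\ge1$ and every $n\ge0$, $$L_n(\boldsymbol{h}(x_1,\dots,x_r),y)=(\tilde{\mathcal D}^-_r+y)^n\,1,$$ where $\tilde{\mathcal D}^-_r=\mathcal D^-_r+\big(\sum_{i=1}^r x_i\big)\,y\frac{\partial}{\partial y}$ and $\mathcal D^-_r=\sum_{i=1}^r\Big(x_i^2+x_i\sum_{j=1}^r x_j\Big)\frac{\partial}{\partial x_i}$, and $y$ acts by multiplication.
   Context: $x_1,\dots,x_r,y$ are indeterminates; $\boldsymbol{h}(x_1,\dots,x_r)=(h_n(x_1,\dots,x_r))_{n\ge0}$ are the complete homogeneous symmetric polynomials ($h_0=1$). Generic Lah polynomials: an ordered tree is a rooted tree with linearly ordered children at each vertex; an increasing ordered tree on a set of integers is one bijectively labeled by that set with children having larger labels than parents. For $\boldsymbol{\phi}=(\phi_i)_{i\ge0}$, $L_{n,k}(\boldsymbol{\phi})$ is the sum over unordered forests of $k$ increasing ordered trees whose vertex sets partition $[n]$ of $\prod_v\phi_{\deg(v)}$ ($\deg(v)$ = number of children; $L_{0,0}=1$), and $L_n(\boldsymbol{\phi},y)=\sum_{k=0}^nL_{n,k}(\boldsymbol{\phi})y^k$. -}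

module Defs where

open import Data.Nat using (ℕ; zero; suc; _+_; _*_; _∸_; pred)
open import Data.Nat.Properties using (_≟_)
open import Data.Fin using (Fin) renaming (zero to fzero; suc to fsuc)
open import Data.Vec using (Vec; []; _∷_; lookup; zipWith; replicate; updateAt; tabulate)
open import Data.Vec.Properties using (≡-dec)
open import Data.List using (List; []; _∷_; _++_; map; concatMap; length; upTo; foldr; [_])
open import Data.Product using (_×_; _,_)
open import Data.Fin using () renaming (_≟_ to _≟F_)
open import Relation.Nullary using (yes; no)
open import Relation.Binary.PropositionalEquality using (_≡_)

-- Polynomials with ℕ coefficients in m variables, as finite lists of
-- terms (coefficient , exponent vector).  Two polynomials are equal
-- when all their coefficients agree.

Mono : ℕ → Set
Mono m = Vec ℕ m

Poly : ℕ → Set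
Poly m = List (ℕ × Mono m)

coeff : ∀ {m} → Poly m → Mono m → ℕ
coeff [] e = 0
coeff ((c , f) ∷ p) e with ≡-dec _≟_ f e
... | yes _ = c + coeff p e
... | no  _ = coeff p e

infix 4 _≈P_
_≈P_ : ∀ {m} → Poly m → Poly m → Set
p ≈P q = ∀ e → coeff p e ≡ coeff q e

zeroP : ∀ {m} → Poly m
zeroP = []

oneP : ∀ {m} → Poly m
oneP {m} = (1 , replicate m 0) ∷ []

varP : ∀ {m} → Fin m → Poly m
varP {m} i = (1 , tabulate (λ j → unit i j)) ∷ []
  where
  unit : Fin m → Fin m → ℕ
  unit i j with i ≟F j
  ... | yes _ = 1
  ... | no  _ = 0

infixl 6 _+P_
infixl 7 _*P_

_+P_ : ∀ {m} → Poly m → Poly m → Poly m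
_+P_ = _++_

_*P_ : ∀ {m} → Poly m → Poly m → Poly m
p *P q = concatMap (λ { (a , e) → map (λ { (b , f) → (a * b , zipWith _+_ e f) }) q }) p

sumP : ∀ {m} → List (Poly m) → Poly m
sumP = foldr _+P_ zeroP

_^P_ : ∀ {m} → Poly m → ℕ → Poly m
p ^P zero = oneP
p ^P suc n = p *P (p ^P n)

∂ : ∀ {m} → Fin m → Poly m → Poly m
∂ i = map (λ { (c , e) → (c * lookup e i , updateAt e i pred) })

-- Variables: polynomials in x₁,…,x_r,y live in Poly (suc r);
-- index fzero is y, index fsuc i is x_{i+1} (i : Fin r).

yP : ∀ {r} → Poly (suc r)
yP = varP fzero

xP : ∀ {r} → Fin r → Poly (suc r)
xP i = varP (fsuc i)

ΣF : ∀ {m} r → (Fin r → Poly m) → Poly m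
ΣF zero    f = zeroP
ΣF (suc r) f = f fzero +P ΣF r (λ i → f (fsuc i))

-- complete homogeneous symmetric polynomial h_k(x₁,…,x_r):
-- sum of all monomials of total degree k in x₁,…,x_r (coefficient 1)
expVecs : ℕ → (r : ℕ) → List (Vec ℕ r)
expVecs zero    zero    = [] ∷ []
expVecs (suc k) zero    = []
expVecs k       (suc r) = concatMap (λ j → map (j ∷_) (expVecs (k ∸ j) r)) (upTo (suc k))

hP : (r : ℕ) → ℕ → Poly (suc r)
hP r k = map (λ e → (1 , 0 ∷ e)) (expVecs k r)

data Tree : Set where
  node : ℕ → List Tree → Tree

Forest : Set
Forest = List Tree

insHere : ℕ → List Tree → List (List Tree)
insHere m []       = (node m [] ∷ []) ∷ []
insHere m (c ∷ cs) = (node m [] ∷ c ∷ cs) ∷ map (c ∷_) (insHere m cs)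

mutual
  insT : ℕ → Tree → List Tree
  insT m (node a cs) = map (node a) (insHere m cs ++ insBelow m cs)

  insBelow : ℕ → List Tree → List (List Tree)
  insBelow m []       = []
  insBelow m (t ∷ ts) = map (_∷ ts) (insT m t) ++ map (t ∷_) (insBelow m ts)

-- Trees of a forest are kept listed in increasing order of root labels,
-- so a list represents an unordered forest canonically.
insF : ℕ → Forest → List Forest
insF m f = (f ++ (node m [] ∷ [])) ∷ insBelow m f

-- the list of all unordered forests of increasing ordered trees on [n],
-- each listed exactly once (vertex n is always a leaf; removing it gives a
-- forest on [n-1], and insF inverts this)
incForests : ℕ → List Forest
incForests zero    = [] ∷ []
incForests (suc n) = concatMap (insF (suc n)) (incForests n)

mutual
  wT : ∀ {m} → (ℕ → Poly m) → Tree → Poly m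
  wT φ (node a cs) = φ (length cs) *P wF φ cs

  wF : ∀ {m} → (ℕ → Poly m) → Forest → Poly m
  wF φ []       = oneP
  wF φ (t ∷ ts) = wT φ t *P wF φ ts

lahPoly : ∀ {r} → (ℕ → Poly (suc r)) → ℕ → Poly (suc r)
lahPoly φ n = sumP (map (λ f → wF φ f *P (yP ^P length f)) (incForests n))

sumX : ∀ r → Poly (suc r)
sumX r = ΣF r xP

Dminus : ∀ r → Poly (suc r) → Poly (suc r)
Dminus r p = ΣF r (λ i → (xP i *P xP i +P xP i *P sumX r) *P ∂ (fsuc i) p)

DminusTilde : ∀ r → Poly (suc r) → Poly (suc r)
DminusTilde r p = Dminus r p +P sumX r *P yP *P ∂ fzero p

opPow : ∀ r → ℕ → Poly (suc r)
opPow r zero    = oneP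
opPow r (suc n) = DminusTilde r (opPow r n) +P yP *P opPow r n

{-# OPTIONS --safe #-}
module Submission where

open import Defs
open import Algebra.Bundles using (CommutativeSemiring)
open import Algebra.Structures.Biased using (isCommutativeSemiringˡ)
open import Data.Fin using (Fin) renaming (zero to fzero; suc to fsuc; _≟_ to _≟F_)
open import Data.List using (List; []; _∷_; _++_; map; concatMap; length; upTo; _∷ʳ_)
import Data.List.Properties as Listₚ
open import Data.List.Relation.Unary.All as All using (All; []; _∷_)
open import Data.List.Relation.Unary.All.Properties using (++⁺; map⁺)
open import Data.Maybe using (nothing)
open import Data.Nat using (ℕ; zero; suc; _+_; _*_; _∸_; pred; _≤_; _<_; _<?_; s≤s; s≤s⁻¹)
open import Data.Nat.Properties
open import Data.Nat.Solver using (module +-*-Solver)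
import Data.Product as Prod
open Prod using (_,_; proj₁; proj₂; uncurry)
open import Data.Sum using ([_,_]′)
open import Data.Vec using (Vec; []; _∷_; lookup; zipWith; replicate; updateAt; tabulate; sum)
import Data.Vec.Properties as Vecₚ
open import Function using (_∘_)
open import Level using (0ℓ)
open import Relation.Binary.PropositionalEquality using (_≡_; _≢_; refl; sym; trans; cong; cong₂; module ≡-Reasoning)
import Relation.Binary.Reasoning.Setoid
open import Relation.Binary.Structures using (IsEquivalence)
open import Relation.Nullary using (¬_; Dec; yes; no; contradiction)
open import Relation.Nullary.Decidable using (_×-dec_)
open import Algebra.Properties.CommutativeSemigroup *-commutativeSemigroup using (x∙yz≈y∙xz)
import Algebra.Solver.Ring.NaturalCoefficients

-- An increasing forest on [n+1] arises from one on [n] by attaching the vertex n+1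
-- either as a new tree, which contributes a factor y, or as a new child of a vertex v
-- in one of the deg v + 1 gaps between its children, which replaces φ_{deg v} by
-- (deg v + 1) φ_{deg v + 1} (as φ_0 = h_0 = 1).  For φ = h this replacement is nearly
-- a derivation: D⁻_r h_d = (d+1) h_{d+1} + (d−1) (Σ x_i) h_d.  Since Σ_v (deg v − 1) = −k
-- on a forest with k trees, D⁻_r falls short of the insertions by k (Σ x_i) times the
-- weight, which is exactly what (Σ x_i) y ∂/∂y supplies on y^k.  Hence
-- L_{n+1} = (D̃⁻_r + y) L_n.

private
  variable
    m : ℕ
    A B : Set

infixl 6 _+ᵛ_ _∸ᵛ_

_+ᵛ_ _∸ᵛ_ : Mono m → Mono m → Mono m
_+ᵛ_ = zipWith _+_
_∸ᵛ_ = zipWith _∸_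

0ᵛ : Mono m
0ᵛ = replicate _ 0

incAt decAt : Fin m → Mono m → Mono m
incAt i e = updateAt e i suc
decAt i e = updateAt e i pred

infix 4 _≟ᵛ_
_≟ᵛ_ : (f e : Mono m) → Dec (f ≡ e)
_≟ᵛ_ = Vecₚ.≡-dec _≟_

+ᵛ-comm : (f g : Mono m) → f +ᵛ g ≡ g +ᵛ f
+ᵛ-comm = Vecₚ.zipWith-comm +-comm

+ᵛ-assoc : (f g h : Mono m) → f +ᵛ g +ᵛ h ≡ f +ᵛ (g +ᵛ h)
+ᵛ-assoc = Vecₚ.zipWith-assoc +-assoc

+ᵛ-identityˡ : (f : Mono m) → 0ᵛ +ᵛ f ≡ f
+ᵛ-identityˡ = Vecₚ.zipWith-identityˡ +-identityˡ

∸ᵛ-identityʳ : (f : Mono m) → f ∸ᵛ 0ᵛ ≡ f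
∸ᵛ-identityʳ = Vecₚ.zipWith-identityʳ λ _ → refl

f+ᵛg∸ᵛf≡g : (f g : Mono m) → f +ᵛ g ∸ᵛ f ≡ g
f+ᵛg∸ᵛf≡g []      []      = refl
f+ᵛg∸ᵛf≡g (a ∷ f) (b ∷ g) = cong₂ _∷_ (m+n∸m≡n a b) (f+ᵛg∸ᵛf≡g f g)

lookup-incAt : (i : Fin m) (e : Mono m) → lookup (incAt i e) i ≡ suc (lookup e i)
lookup-incAt i e = Vecₚ.lookup∘updateAt i e

lookup-decAt : (i : Fin m) (e : Mono m) → lookup (decAt i e) i ≡ pred (lookup e i)
lookup-decAt i e = Vecₚ.lookup∘updateAt i e

decAt-incAt : (i : Fin m) (e : Mono m) → decAt i (incAt i e) ≡ e
decAt-incAt i e = trans (Vecₚ.updateAt-updateAt i e) (Vecₚ.updateAt-id i e)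

incAt-injective : (i : Fin m) {f e : Mono m} → incAt i f ≡ incAt i e → f ≡ e
incAt-injective i {f} {e} f⁺≡e⁺ = trans (sym (decAt-incAt i f)) (trans (cong (decAt i) f⁺≡e⁺) (decAt-incAt i e))

incAt-decAt : (i : Fin m) (e : Mono m) {k : ℕ} → lookup e i ≡ suc k → incAt i (decAt i e) ≡ e
incAt-decAt i e eᵢ≡1+k = trans (Vecₚ.updateAt-updateAt i e)
  (Vecₚ.updateAt-id-local i e (trans (cong (suc ∘ pred) eᵢ≡1+k) (sym eᵢ≡1+k)))

decAt-+ᵛˡ : (i : Fin m) (f g : Mono m) {k : ℕ} → lookup f i ≡ suc k → decAt i (f +ᵛ g) ≡ decAt i f +ᵛ g
decAt-+ᵛˡ fzero    (suc a ∷ f) (b ∷ g) refl = refl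
decAt-+ᵛˡ (fsuc i) (a ∷ f)     (b ∷ g) fᵢ≡1+k = cong (a + b ∷_) (decAt-+ᵛˡ i f g fᵢ≡1+k)

decAt-+ᵛʳ : (i : Fin m) (f g : Mono m) {k : ℕ} → lookup g i ≡ suc k → decAt i (f +ᵛ g) ≡ f +ᵛ decAt i g
decAt-+ᵛʳ i f g gᵢ≡1+k = begin
  decAt i (f +ᵛ g) ≡⟨ cong (decAt i) (+ᵛ-comm f g) ⟩
  decAt i (g +ᵛ f) ≡⟨ decAt-+ᵛˡ i g f gᵢ≡1+k ⟩
  decAt i g +ᵛ f   ≡⟨ +ᵛ-comm (decAt i g) f ⟩
  f +ᵛ decAt i g   ∎
  where open ≡-Reasoning

incAt-0ᵛ-+ᵛ : (i : Fin m) (f : Mono m) → incAt i 0ᵛ +ᵛ f ≡ incAt i f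
incAt-0ᵛ-+ᵛ fzero    (a ∷ f) = cong (suc a ∷_) (+ᵛ-identityˡ f)
incAt-0ᵛ-+ᵛ (fsuc i) (a ∷ f) = cong (a ∷_) (incAt-0ᵛ-+ᵛ i f)

∸ᵛ-incAt-0ᵛ : (i : Fin m) (e : Mono m) → e ∸ᵛ incAt i 0ᵛ ≡ decAt i e
∸ᵛ-incAt-0ᵛ fzero    (a ∷ e) = cong (pred a ∷_) (∸ᵛ-identityʳ e)
∸ᵛ-incAt-0ᵛ (fsuc i) (a ∷ e) = cong (a ∷_) (∸ᵛ-incAt-0ᵛ i e)

sum-incAt : (i : Fin m) (e : Mono m) → sum (incAt i e) ≡ suc (sum e)
sum-incAt fzero    (a ∷ e) = refl
sum-incAt (fsuc i) (a ∷ e) = trans (cong (a +_) (sum-incAt i e)) (+-suc a (sum e))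

sum≡0⇒≡0ᵛ : (e : Mono m) → sum e ≡ 0 → e ≡ 0ᵛ
sum≡0⇒≡0ᵛ []       _  = refl
sum≡0⇒≡0ᵛ (0 ∷ e) Σe≡0 = cong (0 ∷_) (sum≡0⇒≡0ᵛ e Σe≡0)

sum-0ᵛ : sum (0ᵛ {m}) ≡ 0
sum-0ᵛ {zero}  = refl
sum-0ᵛ {suc m} = sum-0ᵛ {m}

[_] : {P : Set} → Dec P → ℕ
[ yes _ ] = 1
[ no  _ ] = 0

[]-yes : {P : Set} (P? : Dec P) → P → [ P? ] ≡ 1
[]-yes (yes _) _ = refl
[]-yes (no ¬p) p = contradiction p ¬p

[]-no : {P : Set} (P? : Dec P) → ¬ P → [ P? ] ≡ 0
[]-no (yes p) ¬p = contradiction p ¬p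
[]-no (no _)  _  = refl

[]-cong : {P Q : Set} (P? : Dec P) (Q? : Dec Q) → (P → Q) → (Q → P) → [ P? ] ≡ [ Q? ]
[]-cong (yes _) (yes _) _ _ = refl
[]-cong (yes p) (no ¬q) P⇒Q _ = contradiction (P⇒Q p) ¬q
[]-cong (no ¬p) (yes q) _ Q⇒P = contradiction (Q⇒P q) ¬p
[]-cong (no _)  (no _)  _ _ = refl

[]-×-dec : {P Q : Set} (P? : Dec P) (Q? : Dec Q) → [ P? ×-dec Q? ] ≡ [ P? ] * [ Q? ]
[]-×-dec (yes _) (yes _) = refl
[]-×-dec (yes _) (no _)  = refl
[]-×-dec (no _)  _       = refl

[]-∷ : (a b : ℕ) (f e : Mono m) → [ a ∷ f ≟ᵛ b ∷ e ] ≡ [ a ≟ b ] * [ f ≟ᵛ e ]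
[]-∷ a b f e = trans ([]-cong (a ∷ f ≟ᵛ b ∷ e) (a ≟ b ×-dec f ≟ᵛ e) Vecₚ.∷-injective (uncurry (cong₂ _∷_)))
                     ([]-×-dec (a ≟ b) (f ≟ᵛ e))

[1+m≟1+n]≡[m≟n] : ∀ m n → [ suc m ≟ suc n ] ≡ [ m ≟ n ]
[1+m≟1+n]≡[m≟n] m n = []-cong (suc m ≟ suc n) (m ≟ n) suc-injective (cong suc)

[m≟n]*G[m]≡[m≟n]*G[n] : ∀ m n (G : ℕ → ℕ) → [ m ≟ n ] * G m ≡ [ m ≟ n ] * G n
[m≟n]*G[m]≡[m≟n]*G[n] m n G with m ≟ n
... | yes refl = refl
... | no _     = refl

[m<?1+n]≡[m<?n]+[n≟m] : ∀ m n → [ m <? suc n ] ≡ [ m <? n ] + [ n ≟ m ]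
[m<?1+n]≡[m<?n]+[n≟m] m n with m <? n | n ≟ m
... | yes m<n | yes refl = contradiction m<n (<-irrefl refl)
... | yes m<n | no _     = []-yes (m <? suc n) (m<n⇒m<1+n m<n)
... | no _    | yes refl = []-yes (m <? suc n) (n<1+n m)
... | no m≮n  | no n≢m   = []-no (m <? suc n) ([ m≮n , n≢m ∘ sym ]′ ∘ m<1+n⇒m<n∨m≡n)

∑ : List A → (A → ℕ) → ℕ
∑ []       F = 0
∑ (x ∷ xs) F = F x + ∑ xs F

∑-++ : (xs ys : List A) (F : A → ℕ) → ∑ (xs ++ ys) F ≡ ∑ xs F + ∑ ys F
∑-++ []       ys F = refl
∑-++ (x ∷ xs) ys F = trans (cong (F x +_) (∑-++ xs ys F)) (sym (+-assoc (F x) _ _))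

∑-map : (g : B → A) (xs : List B) (F : A → ℕ) → ∑ (map g xs) F ≡ ∑ xs (F ∘ g)
∑-map g []       F = refl
∑-map g (x ∷ xs) F = cong (F (g x) +_) (∑-map g xs F)

∑-concatMap : (g : B → List A) (xs : List B) (F : A → ℕ) → ∑ (concatMap g xs) F ≡ ∑ xs (λ x → ∑ (g x) F)
∑-concatMap g []       F = refl
∑-concatMap g (x ∷ xs) F = trans (∑-++ (g x) (concatMap g xs) F) (cong (∑ (g x) F +_) (∑-concatMap g xs F))

∑-cong : (xs : List A) {F G : A → ℕ} → (∀ x → F x ≡ G x) → ∑ xs F ≡ ∑ xs G
∑-cong []       F≗G = refl
∑-cong (x ∷ xs) F≗G = cong₂ _+_ (F≗G x) (∑-cong xs F≗G)

∑-zero : (xs : List A) → ∑ xs (λ _ → 0) ≡ 0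
∑-zero []       = refl
∑-zero (x ∷ xs) = ∑-zero xs

∑-+ : (xs : List A) (F G : A → ℕ) → ∑ xs (λ x → F x + G x) ≡ ∑ xs F + ∑ xs G
∑-+ []       F G = refl
∑-+ (x ∷ xs) F G = trans (cong (F x + G x +_) (∑-+ xs F G)) (+-assoc-swap (F x) (G x) (∑ xs F) (∑ xs G))
  where
  open +-*-Solver
  +-assoc-swap : ∀ a b c d → a + b + (c + d) ≡ a + c + (b + d)
  +-assoc-swap = solve 4 (λ a b c d → a :+ b :+ (c :+ d) := a :+ c :+ (b :+ d)) refl

∑-*ˡ : (xs : List A) (k : ℕ) (F : A → ℕ) → ∑ xs (λ x → k * F x) ≡ k * ∑ xs F
∑-*ˡ []       k F = sym (*-zeroʳ k)
∑-*ˡ (x ∷ xs) k F = trans (cong (k * F x +_) (∑-*ˡ xs k F)) (sym (*-distribˡ-+ k (F x) _))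

∑-comm : (xs : List A) (ys : List B) (F : A → B → ℕ) →
         ∑ xs (λ x → ∑ ys (F x)) ≡ ∑ ys (λ y → ∑ xs (λ x → F x y))
∑-comm []       ys F = sym (∑-zero ys)
∑-comm (x ∷ xs) ys F = trans (cong (∑ ys (F x) +_) (∑-comm xs ys F)) (sym (∑-+ ys (F x) _))

Term : ℕ → Set
Term m = ℕ Prod.× Mono m

contrib : Mono m → Term m → ℕ
contrib e t = proj₁ t * [ proj₂ t ≟ᵛ e ]

infixl 7 _⊗_
_⊗_ : Term m → Term m → Term m
(a , f) ⊗ (b , g) = a * b , f +ᵛ g

∂ᵗ : Fin m → Term m → Term m
∂ᵗ i (c , f) = c * lookup f i , decAt i f

coeff-∑ : (p : Poly m) (e : Mono m) → coeff p e ≡ ∑ p (contrib e)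
coeff-∑ []            e = refl
coeff-∑ ((c , f) ∷ p) e with f ≟ᵛ e
... | yes _ = cong₂ _+_ (sym (*-identityʳ c)) (coeff-∑ p e)
... | no  _ = cong₂ _+_ (sym (*-zeroʳ c)) (coeff-∑ p e)

∑-*P : (p q : Poly m) (F : Term m → ℕ) → ∑ (p *P q) F ≡ ∑ p (λ s → ∑ q (λ t → F (s ⊗ t)))
∑-*P p q F = trans (∑-concatMap _ p F) (∑-cong p λ s → ∑-map _ q F)

∑-∂ : (i : Fin m) (p : Poly m) (F : Term m → ℕ) → ∑ (∂ i p) F ≡ ∑ p (F ∘ ∂ᵗ i)
∑-∂ i p F = ∑-map _ p F

coeff-+P : (p q : Poly m) (e : Mono m) → coeff (p +P q) e ≡ coeff p e + coeff q e
coeff-+P p q e = begin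
  coeff (p ++ q) e            ≡⟨ coeff-∑ (p ++ q) e ⟩
  ∑ (p ++ q) (contrib e)      ≡⟨ ∑-++ p q (contrib e) ⟩
  ∑ p (contrib e) + ∑ q (contrib e) ≡⟨ sym (cong₂ _+_ (coeff-∑ p e) (coeff-∑ q e)) ⟩
  coeff p e + coeff q e       ∎
  where open ≡-Reasoning

[]-+ᵛ-split : (f g e : Mono m) → [ f +ᵛ g ≟ᵛ e ] ≡ [ g ≟ᵛ e ∸ᵛ f ] * [ f +ᵛ (e ∸ᵛ f) ≟ᵛ e ]
[]-+ᵛ-split f g e = trans ([]-cong (f +ᵛ g ≟ᵛ e) (g ≟ᵛ e ∸ᵛ f ×-dec f +ᵛ (e ∸ᵛ f) ≟ᵛ e) split join)
                          ([]-×-dec (g ≟ᵛ e ∸ᵛ f) (f +ᵛ (e ∸ᵛ f) ≟ᵛ e))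
  where
  split : f +ᵛ g ≡ e → g ≡ e ∸ᵛ f Prod.× f +ᵛ (e ∸ᵛ f) ≡ e
  split refl = sym (f+ᵛg∸ᵛf≡g f g) , cong (f +ᵛ_) (f+ᵛg∸ᵛf≡g f g)
  join : g ≡ e ∸ᵛ f Prod.× f +ᵛ (e ∸ᵛ f) ≡ e → f +ᵛ g ≡ e
  join (refl , f+e∸f≡e) = f+e∸f≡e

-- The bracket tests f ≤ e pointwise: only then does the exponent e ∸ᵛ f complement f to e.
coeff-*P : (p q : Poly m) (e : Mono m) →
           coeff (p *P q) e ≡ ∑ p (λ s → proj₁ s * ([ proj₂ s +ᵛ (e ∸ᵛ proj₂ s) ≟ᵛ e ] * coeff q (e ∸ᵛ proj₂ s)))
coeff-*P p q e = begin
  coeff (p *P q) e                                  ≡⟨ coeff-∑ (p *P q) e ⟩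
  ∑ (p *P q) (contrib e)                            ≡⟨ ∑-*P p q (contrib e) ⟩
  ∑ p (λ s → ∑ q (λ t → contrib e (s ⊗ t)))         ≡⟨ ∑-cong p (λ { (a , f) → row a f }) ⟩
  ∑ p (λ s → proj₁ s * ([ proj₂ s +ᵛ (e ∸ᵛ proj₂ s) ≟ᵛ e ] * coeff q (e ∸ᵛ proj₂ s))) ∎
  where
  open ≡-Reasoning
  open +-*-Solver
  row : ∀ a f → ∑ q (λ t → contrib e ((a , f) ⊗ t)) ≡ a * ([ f +ᵛ (e ∸ᵛ f) ≟ᵛ e ] * coeff q (e ∸ᵛ f))
  row a f = begin
    ∑ q (λ t → a * proj₁ t * [ f +ᵛ proj₂ t ≟ᵛ e ])
      ≡⟨ ∑-cong q (λ t → cong (a * proj₁ t *_) ([]-+ᵛ-split f (proj₂ t) e)) ⟩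
    ∑ q (λ t → a * proj₁ t * ([ proj₂ t ≟ᵛ e ∸ᵛ f ] * I))
      ≡⟨ ∑-cong q (λ t → reassoc a (proj₁ t) [ proj₂ t ≟ᵛ e ∸ᵛ f ] I) ⟩
    ∑ q (λ t → a * I * contrib (e ∸ᵛ f) t)
      ≡⟨ ∑-*ˡ q (a * I) (contrib (e ∸ᵛ f)) ⟩
    a * I * ∑ q (contrib (e ∸ᵛ f))
      ≡⟨ cong (a * I *_) (sym (coeff-∑ q (e ∸ᵛ f))) ⟩
    a * I * coeff q (e ∸ᵛ f)
      ≡⟨ *-assoc a I _ ⟩
    a * (I * coeff q (e ∸ᵛ f)) ∎
    where
    I = [ f +ᵛ (e ∸ᵛ f) ≟ᵛ e ]
    reassoc : ∀ a b x y → a * b * (x * y) ≡ a * y * (b * x)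
    reassoc = solve 4 (λ a b x y → a :* b :* (x :* y) := a :* y :* (b :* x)) refl

-- The commutative semiring of polynomials

infix 4 _≋_

-- ≈P wrapped in a record, so that both sides can be inferred from a proof
-- (as the setoid reasoning and the ring solver below require).
record _≋_ (p q : Poly m) : Set where
  constructor mk≋
  field ≋⇒≈P : p ≈P q
open _≋_

≡⇒≋ : {p q : Poly m} → p ≡ q → p ≋ q
≡⇒≋ refl = mk≋ λ _ → refl

∑contrib⇒≋ : {p q : Poly m} → (∀ e → ∑ p (contrib e) ≡ ∑ q (contrib e)) → p ≋ q
∑contrib⇒≋ {p = p} {q} ∑p≡∑q = mk≋ λ e → trans (coeff-∑ p e) (trans (∑p≡∑q e) (sym (coeff-∑ q e)))

∑≡∑⇒≋ : {p q : Poly m} → (∀ F → ∑ p F ≡ ∑ q F) → p ≋ q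
∑≡∑⇒≋ ∑p≡∑q = ∑contrib⇒≋ λ e → ∑p≡∑q (contrib e)

⊗-comm : (s t : Term m) → s ⊗ t ≡ t ⊗ s
⊗-comm (a , f) (b , g) = cong₂ _,_ (*-comm a b) (+ᵛ-comm f g)

⊗-assoc : (s t u : Term m) → s ⊗ t ⊗ u ≡ s ⊗ (t ⊗ u)
⊗-assoc (a , f) (b , g) (c , h) = cong₂ _,_ (*-assoc a b c) (+ᵛ-assoc f g h)

⊗-identityˡ : (t : Term m) → (1 , 0ᵛ) ⊗ t ≡ t
⊗-identityˡ (b , g) = cong₂ _,_ (*-identityˡ b) (+ᵛ-identityˡ g)

≋-refl : {p : Poly m} → p ≋ p
≋-refl = mk≋ λ _ → refl

≋-sym : {p q : Poly m} → p ≋ q → q ≋ p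
≋-sym p≋q = mk≋ λ e → sym (≋⇒≈P p≋q e)

≋-trans : {p q r : Poly m} → p ≋ q → q ≋ r → p ≋ r
≋-trans p≋q q≋r = mk≋ λ e → trans (≋⇒≈P p≋q e) (≋⇒≈P q≋r e)

≋-isEquivalence : IsEquivalence (_≋_ {m})
≋-isEquivalence = record { refl = ≋-refl ; sym = ≋-sym ; trans = ≋-trans }

module _ {m : ℕ} where

  open ≡-Reasoning

  +P-cong : {p p′ q q′ : Poly m} → p ≋ p′ → q ≋ q′ → p +P q ≋ p′ +P q′
  +P-cong {p} {p′} {q} {q′} p≋p′ q≋q′ = mk≋ λ e → begin
    coeff (p +P q) e         ≡⟨ coeff-+P p q e ⟩
    coeff p e + coeff q e    ≡⟨ cong₂ _+_ (≋⇒≈P p≋p′ e) (≋⇒≈P q≋q′ e) ⟩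
    coeff p′ e + coeff q′ e  ≡⟨ coeff-+P p′ q′ e ⟨
    coeff (p′ +P q′) e       ∎

  +P-assoc : (p q r : Poly m) → p +P q +P r ≋ p +P (q +P r)
  +P-assoc p q r = ≡⇒≋ (Listₚ.++-assoc p q r)

  +P-comm : (p q : Poly m) → p +P q ≋ q +P p
  +P-comm p q = ∑≡∑⇒≋ λ F → begin
    ∑ (p ++ q) F       ≡⟨ ∑-++ p q F ⟩
    ∑ p F + ∑ q F      ≡⟨ +-comm (∑ p F) (∑ q F) ⟩
    ∑ q F + ∑ p F      ≡⟨ ∑-++ q p F ⟨
    ∑ (q ++ p) F       ∎

  +P-identityʳ : (p : Poly m) → p +P zeroP ≋ p
  +P-identityʳ p = ≡⇒≋ (Listₚ.++-identityʳ p)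

  *P-comm : (p q : Poly m) → p *P q ≋ q *P p
  *P-comm p q = ∑≡∑⇒≋ λ F → begin
    ∑ (p *P q) F                                 ≡⟨ ∑-*P p q F ⟩
    ∑ p (λ s → ∑ q (λ t → F (s ⊗ t)))            ≡⟨ ∑-comm p q (λ s t → F (s ⊗ t)) ⟩
    ∑ q (λ t → ∑ p (λ s → F (s ⊗ t)))            ≡⟨ ∑-cong q (λ t → ∑-cong p (λ s → cong F (⊗-comm s t))) ⟩
    ∑ q (λ t → ∑ p (λ s → F (t ⊗ s)))            ≡⟨ ∑-*P q p F ⟨
    ∑ (q *P p) F                                 ∎

  *P-assoc : (p q r : Poly m) → p *P q *P r ≋ p *P (q *P r)
  *P-assoc p q r = ∑≡∑⇒≋ λ F → begin
    ∑ (p *P q *P r) F                                        ≡⟨ ∑-*P (p *P q) r F ⟩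
    ∑ (p *P q) (λ u → ∑ r (λ w → F (u ⊗ w)))                 ≡⟨ ∑-*P p q _ ⟩
    ∑ p (λ s → ∑ q (λ t → ∑ r (λ w → F (s ⊗ t ⊗ w))))        ≡⟨ ∑-cong p (λ s → ∑-cong q (λ t → ∑-cong r (λ w → cong F (⊗-assoc s t w)))) ⟩
    ∑ p (λ s → ∑ q (λ t → ∑ r (λ w → F (s ⊗ (t ⊗ w)))))      ≡⟨ ∑-cong p (λ s → ∑-*P q r (λ v → F (s ⊗ v))) ⟨
    ∑ p (λ s → ∑ (q *P r) (λ v → F (s ⊗ v)))                 ≡⟨ ∑-*P p (q *P r) F ⟨
    ∑ (p *P (q *P r)) F                                      ∎

  *P-distribˡ : (p q r : Poly m) → p *P (q +P r) ≋ p *P q +P p *P r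
  *P-distribˡ p q r = ∑≡∑⇒≋ λ F → begin
    ∑ (p *P (q ++ r)) F                                      ≡⟨ ∑-*P p (q ++ r) F ⟩
    ∑ p (λ s → ∑ (q ++ r) (λ t → F (s ⊗ t)))                 ≡⟨ ∑-cong p (λ s → ∑-++ q r _) ⟩
    ∑ p (λ s → ∑ q (λ t → F (s ⊗ t)) + ∑ r (λ t → F (s ⊗ t))) ≡⟨ ∑-+ p _ _ ⟩
    ∑ p (λ s → ∑ q (λ t → F (s ⊗ t))) + ∑ p (λ s → ∑ r (λ t → F (s ⊗ t)))
                                                             ≡⟨ cong₂ _+_ (∑-*P p q F) (∑-*P p r F) ⟨
    ∑ (p *P q) F + ∑ (p *P r) F                              ≡⟨ ∑-++ (p *P q) (p *P r) F ⟨
    ∑ (p *P q ++ p *P r) F                                   ∎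

  *P-identityˡ : (p : Poly m) → oneP *P p ≋ p
  *P-identityˡ p = ∑≡∑⇒≋ λ F → begin
    ∑ (oneP *P p) F                        ≡⟨ ∑-*P oneP p F ⟩
    ∑ p (λ t → F ((1 , 0ᵛ) ⊗ t)) + 0       ≡⟨ +-identityʳ _ ⟩
    ∑ p (λ t → F ((1 , 0ᵛ) ⊗ t))           ≡⟨ ∑-cong p (λ t → cong F (⊗-identityˡ t)) ⟩
    ∑ p F                                  ∎

  *P-congˡ : (p : Poly m) {q q′ : Poly m} → q ≋ q′ → p *P q ≋ p *P q′
  *P-congˡ p {q} {q′} q≋q′ = mk≋ λ e → begin
    coeff (p *P q) e  ≡⟨ coeff-*P p q e ⟩
    ∑ p (λ s → proj₁ s * ([ proj₂ s +ᵛ (e ∸ᵛ proj₂ s) ≟ᵛ e ] * coeff q (e ∸ᵛ proj₂ s)))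
      ≡⟨ ∑-cong p (λ s → cong (λ c → proj₁ s * ([ proj₂ s +ᵛ (e ∸ᵛ proj₂ s) ≟ᵛ e ] * c)) (≋⇒≈P q≋q′ (e ∸ᵛ proj₂ s))) ⟩
    ∑ p (λ s → proj₁ s * ([ proj₂ s +ᵛ (e ∸ᵛ proj₂ s) ≟ᵛ e ] * coeff q′ (e ∸ᵛ proj₂ s)))
      ≡⟨ coeff-*P p q′ e ⟨
    coeff (p *P q′) e ∎

  +P-congˡ : (p : Poly m) {q q′ : Poly m} → q ≋ q′ → p +P q ≋ p +P q′
  +P-congˡ p = +P-cong ≋-refl

  +P-congʳ : (q : Poly m) {p p′ : Poly m} → p ≋ p′ → p +P q ≋ p′ +P q
  +P-congʳ q p≋p′ = +P-cong p≋p′ ≋-refl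

  *P-congʳ : (q : Poly m) {p p′ : Poly m} → p ≋ p′ → p *P q ≋ p′ *P q
  *P-congʳ q {p} {p′} p≋p′ = ≋-trans (*P-comm p q) (≋-trans (*P-congˡ q p≋p′) (*P-comm q p′))

  *P-cong : {p p′ q q′ : Poly m} → p ≋ p′ → q ≋ q′ → p *P q ≋ p′ *P q′
  *P-cong {p} {p′} {q} {q′} p≋p′ q≋q′ = ≋-trans (*P-congʳ q p≋p′) (*P-congˡ p′ q≋q′)

  *P-distribʳ : (p q r : Poly m) → (q +P r) *P p ≋ q *P p +P r *P p
  *P-distribʳ p q r = ≋-trans (*P-comm (q +P r) p)
    (≋-trans (*P-distribˡ p q r) (+P-cong (*P-comm p q) (*P-comm p r)))

  PolyCS : CommutativeSemiring 0ℓ 0ℓ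
  PolyCS = record
    { Carrier = Poly m
    ; _≈_ = _≋_
    ; _+_ = _+P_
    ; _*_ = _*P_
    ; 0# = zeroP
    ; 1# = oneP
    ; isCommutativeSemiring = isCommutativeSemiringˡ record
      { +-isCommutativeMonoid = record
        { isMonoid = record
          { isSemigroup = record
            { isMagma = record { isEquivalence = ≋-isEquivalence ; ∙-cong = +P-cong }
            ; assoc = +P-assoc }
          ; identity = (λ _ → ≋-refl) , +P-identityʳ }
        ; comm = +P-comm }
      ; *-isCommutativeMonoid = record
        { isMonoid = record
          { isSemigroup = record
            { isMagma = record { isEquivalence = ≋-isEquivalence ; ∙-cong = *P-cong }
            ; assoc = *P-assoc }
          ; identity = *P-identityˡ , (λ p → ≋-trans (*P-comm p oneP) (*P-identityˡ p)) }
        ; comm = *P-comm }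
      ; distribʳ = *P-distribʳ
      ; zeroˡ = λ _ → ≋-refl }
    }

module ≋-Reasoning {m : ℕ} = Relation.Binary.Reasoning.Setoid (CommutativeSemiring.setoid (PolyCS {m}))

module PolySolver {m : ℕ} = Algebra.Solver.Ring.NaturalCoefficients (PolyCS {m}) (λ _ _ → nothing)

natP : ℕ → Poly m
natP zero    = zeroP
natP (suc n) = oneP +P natP n

coeff-natP-*P : (n : ℕ) (p : Poly m) (e : Mono m) → coeff (natP n *P p) e ≡ n * coeff p e
coeff-natP-*P zero    p e = refl
coeff-natP-*P (suc n) p e = begin
  coeff ((oneP +P natP n) *P p) e               ≡⟨ ≋⇒≈P (*P-distribʳ p oneP (natP n)) e ⟩
  coeff (oneP *P p +P natP n *P p) e            ≡⟨ coeff-+P (oneP *P p) (natP n *P p) e ⟩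
  coeff (oneP *P p) e + coeff (natP n *P p) e   ≡⟨ cong₂ _+_ (≋⇒≈P (*P-identityˡ p) e) (coeff-natP-*P n p e) ⟩
  coeff p e + n * coeff p e                     ∎
  where open ≡-Reasoning

-- Derivations

lookup-*-[decAt] : (i : Fin m) (f e : Mono m) →
                   lookup f i * [ decAt i f ≟ᵛ e ] ≡ suc (lookup e i) * [ f ≟ᵛ incAt i e ]
lookup-*-[decAt] i f e with f ≟ᵛ incAt i e
... | yes refl = cong₂ _*_ (lookup-incAt i e) ([]-yes (decAt i (incAt i e) ≟ᵛ e) (decAt-incAt i e))
... | no f≢e⁺ with lookup f i in fᵢ≡
...   | zero  = sym (*-zeroʳ (suc (lookup e i)))
...   | suc k = trans (cong (suc k *_) ([]-no (decAt i f ≟ᵛ e) f⁻≢e)) (trans (*-zeroʳ (suc k)) (sym (*-zeroʳ (suc (lookup e i)))))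
  where
  f⁻≢e : decAt i f ≢ e
  f⁻≢e f⁻≡e = f≢e⁺ (trans (sym (incAt-decAt i f fᵢ≡)) (cong (incAt i) f⁻≡e))

coeff-∂ : (i : Fin m) (p : Poly m) (e : Mono m) → coeff (∂ i p) e ≡ suc (lookup e i) * coeff p (incAt i e)
coeff-∂ i p e = begin
  coeff (∂ i p) e                                   ≡⟨ coeff-∑ (∂ i p) e ⟩
  ∑ (∂ i p) (contrib e)                             ≡⟨ ∑-∂ i p (contrib e) ⟩
  ∑ p (contrib e ∘ ∂ᵗ i)                            ≡⟨ ∑-cong p (λ t → term (proj₁ t) (proj₂ t)) ⟩
  ∑ p (λ t → suc (lookup e i) * contrib (incAt i e) t) ≡⟨ ∑-*ˡ p (suc (lookup e i)) (contrib (incAt i e)) ⟩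
  suc (lookup e i) * ∑ p (contrib (incAt i e))       ≡⟨ cong (suc (lookup e i) *_) (coeff-∑ p (incAt i e)) ⟨
  suc (lookup e i) * coeff p (incAt i e)             ∎
  where
  open ≡-Reasoning
  term : ∀ c f → c * lookup f i * [ decAt i f ≟ᵛ e ] ≡ suc (lookup e i) * (c * [ f ≟ᵛ incAt i e ])
  term c f = begin
    c * lookup f i * [ decAt i f ≟ᵛ e ]           ≡⟨ *-assoc c _ _ ⟩
    c * (lookup f i * [ decAt i f ≟ᵛ e ])         ≡⟨ cong (c *_) (lookup-*-[decAt] i f e) ⟩
    c * (suc (lookup e i) * [ f ≟ᵛ incAt i e ])   ≡⟨ x∙yz≈y∙xz c (suc (lookup e i)) _ ⟩
    suc (lookup e i) * (c * [ f ≟ᵛ incAt i e ])   ∎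

lookup-*-decAt-+ᵛˡ : (i : Fin m) (f g : Mono m) (F : Mono m → ℕ) →
                     lookup f i * F (decAt i (f +ᵛ g)) ≡ lookup f i * F (decAt i f +ᵛ g)
lookup-*-decAt-+ᵛˡ i f g F with lookup f i in fᵢ≡
... | zero  = refl
... | suc k = cong (λ h → suc k * F h) (decAt-+ᵛˡ i f g fᵢ≡)

lookup-*-decAt-+ᵛʳ : (i : Fin m) (f g : Mono m) (F : Mono m → ℕ) →
                     lookup g i * F (decAt i (f +ᵛ g)) ≡ lookup g i * F (f +ᵛ decAt i g)
lookup-*-decAt-+ᵛʳ i f g F with lookup g i in gᵢ≡
... | zero  = refl
... | suc k = cong (λ h → suc k * F h) (decAt-+ᵛʳ i f g gᵢ≡)

contrib-∂ᵗ-⊗ : (i : Fin m) (e : Mono m) (s t : Term m) →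
               contrib e (∂ᵗ i (s ⊗ t)) ≡ contrib e (∂ᵗ i s ⊗ t) + contrib e (s ⊗ ∂ᵗ i t)
contrib-∂ᵗ-⊗ i e (a , f) (b , g) = begin
  a * b * lookup (f +ᵛ g) i * [ decAt i (f +ᵛ g) ≟ᵛ e ]
    ≡⟨ cong (λ x → a * b * x * [ decAt i (f +ᵛ g) ≟ᵛ e ]) (Vecₚ.lookup-zipWith _+_ i f g) ⟩
  a * b * (lookup f i + lookup g i) * [ decAt i (f +ᵛ g) ≟ᵛ e ]
    ≡⟨ expand a b (lookup f i) (lookup g i) _ ⟩
  a * b * (lookup f i * [ decAt i (f +ᵛ g) ≟ᵛ e ]) + a * b * (lookup g i * [ decAt i (f +ᵛ g) ≟ᵛ e ])
    ≡⟨ cong₂ (λ x y → a * b * x + a * b * y) (lookup-*-decAt-+ᵛˡ i f g (λ h → [ h ≟ᵛ e ])) (lookup-*-decAt-+ᵛʳ i f g (λ h → [ h ≟ᵛ e ])) ⟩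
  a * b * (lookup f i * [ decAt i f +ᵛ g ≟ᵛ e ]) + a * b * (lookup g i * [ f +ᵛ decAt i g ≟ᵛ e ])
    ≡⟨ regroup a b (lookup f i) (lookup g i) _ _ ⟩
  a * lookup f i * b * [ decAt i f +ᵛ g ≟ᵛ e ] + a * (b * lookup g i) * [ f +ᵛ decAt i g ≟ᵛ e ] ∎
  where
  open ≡-Reasoning
  open +-*-Solver
  expand : ∀ a b x y I → a * b * (x + y) * I ≡ a * b * (x * I) + a * b * (y * I)
  expand = solve 5 (λ a b x y I → a :* b :* (x :+ y) :* I := a :* b :* (x :* I) :+ a :* b :* (y :* I)) refl
  regroup : ∀ a b x y I J → a * b * (x * I) + a * b * (y * J) ≡ a * x * b * I + a * (b * y) * J
  regroup = solve 6 (λ a b x y I J → a :* b :* (x :* I) :+ a :* b :* (y :* J) := a :* x :* b :* I :+ a :* (b :* y) :* J) refl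

∂-leibniz : (i : Fin m) (p q : Poly m) → ∂ i (p *P q) ≋ ∂ i p *P q +P p *P ∂ i q
∂-leibniz i p q = ∑contrib⇒≋ λ e → begin
  ∑ (∂ i (p *P q)) (contrib e)                                 ≡⟨ ∑-∂ i (p *P q) (contrib e) ⟩
  ∑ (p *P q) (contrib e ∘ ∂ᵗ i)                                ≡⟨ ∑-*P p q (contrib e ∘ ∂ᵗ i) ⟩
  ∑ p (λ s → ∑ q (λ t → contrib e (∂ᵗ i (s ⊗ t))))
    ≡⟨ ∑-cong p (λ s → trans (∑-cong q (contrib-∂ᵗ-⊗ i e s)) (∑-+ q _ _)) ⟩
  ∑ p (λ s → ∑ q (λ t → contrib e (∂ᵗ i s ⊗ t)) + ∑ q (λ t → contrib e (s ⊗ ∂ᵗ i t)))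
    ≡⟨ ∑-+ p _ _ ⟩
  ∑ p (λ s → ∑ q (λ t → contrib e (∂ᵗ i s ⊗ t))) + ∑ p (λ s → ∑ q (λ t → contrib e (s ⊗ ∂ᵗ i t)))
    ≡⟨ cong₂ _+_ (trans (∑-*P (∂ i p) q (contrib e)) (∑-∂ i p _)) (trans (∑-*P p (∂ i q) (contrib e)) (∑-cong p λ s → ∑-∂ i q _)) ⟨
  ∑ (∂ i p *P q) (contrib e) + ∑ (p *P ∂ i q) (contrib e)      ≡⟨ ∑-++ (∂ i p *P q) (p *P ∂ i q) (contrib e) ⟨
  ∑ (∂ i p *P q +P p *P ∂ i q) (contrib e)                     ∎
  where open ≡-Reasoning

record IsDerivation (D : Poly m → Poly m) : Set where
  field
    D-cong     : {p q : Poly m} → p ≋ q → D p ≋ D q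
    D-additive : (p q : Poly m) → D (p +P q) ≋ D p +P D q
    D-leibniz  : (p q : Poly m) → D (p *P q) ≋ D p *P q +P p *P D q
open IsDerivation public

∂-isDerivation : (i : Fin m) → IsDerivation (∂ i)
∂-isDerivation i = record
  { D-cong     = λ {p} {q} p≋q → mk≋ λ e →
      trans (coeff-∂ i p e) (trans (cong (suc (lookup e i) *_) (≋⇒≈P p≋q (incAt i e))) (sym (coeff-∂ i q e)))
  ; D-additive = λ p q → ≡⇒≋ (Listₚ.map-++ _ p q)
  ; D-leibniz  = ∂-leibniz i
  }

module _ {m : ℕ} where
  open PolySolver {m}

  x≋x+x⇒x≋0 : {x : Poly m} → x ≋ x +P x → x ≋ zeroP
  x≋x+x⇒x≋0 {x} x≋x+x = mk≋ λ e →
    sym (+-cancelˡ-≡ (coeff x e) 0 (coeff x e) (trans (+-identityʳ _) (trans (≋⇒≈P x≋x+x e) (coeff-+P x x e))))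

  module _ {D : Poly m → Poly m} (D-der : IsDerivation D) where

    D-zero : D zeroP ≋ zeroP
    D-zero = x≋x+x⇒x≋0 (D-additive D-der zeroP zeroP)

    D-one : D oneP ≋ zeroP
    D-one = x≋x+x⇒x≋0 (begin
      D oneP                             ≈⟨ D-cong D-der (solve 0 (con 1 := con 1 :* con 1) ≋-refl) ⟩
      D (oneP *P oneP)                   ≈⟨ D-leibniz D-der oneP oneP ⟩
      D oneP *P oneP +P oneP *P D oneP   ≈⟨ solve 1 (λ d → d :* con 1 :+ con 1 :* d := d :+ d) ≋-refl (D oneP) ⟩
      D oneP +P D oneP                   ∎)
      where open ≋-Reasoning

    D-*P-zero : {p q : Poly m} → D p ≋ zeroP → D q ≋ zeroP → D (p *P q) ≋ zeroP
    D-*P-zero {p} {q} Dp≋0 Dq≋0 = begin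
      D (p *P q)                 ≈⟨ D-leibniz D-der p q ⟩
      D p *P q +P p *P D q       ≈⟨ +P-cong (*P-congʳ q Dp≋0) (*P-congˡ p Dq≋0) ⟩
      zeroP *P q +P p *P zeroP   ≈⟨ solve 2 (λ q p → con 0 :* q :+ p :* con 0 := con 0) ≋-refl q p ⟩
      zeroP                      ∎
      where open ≋-Reasoning

    D-^P : (p : Poly m) → D p ≋ zeroP → ∀ k → D (p ^P k) ≋ zeroP
    D-^P p Dp≋0 zero    = D-one
    D-^P p Dp≋0 (suc k) = D-*P-zero Dp≋0 (D-^P p Dp≋0 k)

    D-sumP : (g : A → Poly m) (xs : List A) → D (sumP (map g xs)) ≋ sumP (map (D ∘ g) xs)
    D-sumP g []       = D-zero
    D-sumP g (x ∷ xs) = ≋-trans (D-additive D-der (g x) _) (+P-congˡ (D (g x)) (D-sumP g xs))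

  *-isDerivation : (c : Poly m) {D : Poly m → Poly m} → IsDerivation D → IsDerivation (λ p → c *P D p)
  *-isDerivation c {D} D-der = record
    { D-cong     = λ p≋q → *P-congˡ c (D-cong D-der p≋q)
    ; D-additive = λ p q → ≋-trans (*P-congˡ c (D-additive D-der p q))
        (solve 3 (λ c a b → c :* (a :+ b) := c :* a :+ c :* b) ≋-refl c (D p) (D q))
    ; D-leibniz  = λ p q → ≋-trans (*P-congˡ c (D-leibniz D-der p q))
        (solve 5 (λ c a q p b → c :* (a :* q :+ p :* b) := c :* a :* q :+ p :* (c :* b)) ≋-refl c (D p) q p (D q))
    }

  +-isDerivation : {D₁ D₂ : Poly m → Poly m} → IsDerivation D₁ → IsDerivation D₂ → IsDerivation (λ p → D₁ p +P D₂ p)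
  +-isDerivation {D₁} {D₂} D₁-der D₂-der = record
    { D-cong     = λ p≋q → +P-cong (D-cong D₁-der p≋q) (D-cong D₂-der p≋q)
    ; D-additive = λ p q → ≋-trans (+P-cong (D-additive D₁-der p q) (D-additive D₂-der p q))
        (solve 4 (λ a b c d → (a :+ b) :+ (c :+ d) := (a :+ c) :+ (b :+ d)) ≋-refl (D₁ p) (D₁ q) (D₂ p) (D₂ q))
    ; D-leibniz  = λ p q → ≋-trans (+P-cong (D-leibniz D₁-der p q) (D-leibniz D₂-der p q))
        (solve 6 (λ a q p b c d → (a :* q :+ p :* b) :+ (c :* q :+ p :* d) := (a :+ c) :* q :+ p :* (b :+ d)) ≋-refl
          (D₁ p) q p (D₁ q) (D₂ p) (D₂ q))
    }

  zero-isDerivation : IsDerivation (λ (_ : Poly m) → zeroP)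
  zero-isDerivation = record
    { D-cong     = λ _ → ≋-refl
    ; D-additive = λ _ _ → ≋-refl
    ; D-leibniz  = λ p q → solve 2 (λ p q → con 0 := con 0 :* q :+ p :* con 0) ≋-refl p q
    }

  ΣF-isDerivation : ∀ r (c : Fin r → Poly m) (D : Fin r → Poly m → Poly m) →
                    (∀ i → IsDerivation (D i)) → IsDerivation (λ p → ΣF r (λ i → c i *P D i p))
  ΣF-isDerivation zero    c D D-der = zero-isDerivation
  ΣF-isDerivation (suc r) c D D-der = +-isDerivation (*-isDerivation (c fzero) (D-der fzero))
    (ΣF-isDerivation r (c ∘ fsuc) (D ∘ fsuc) (D-der ∘ fsuc))

coeff-single : (c : ℕ) (f e : Mono m) → coeff ((c , f) ∷ []) e ≡ c * [ f ≟ᵛ e ]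
coeff-single c f e = trans (coeff-∑ ((c , f) ∷ []) e) (+-identityʳ _)

coeff-single-*P : (c : ℕ) (f : Mono m) (q : Poly m) (e : Mono m) →
                  coeff (((c , f) ∷ []) *P q) e ≡ c * ([ f +ᵛ (e ∸ᵛ f) ≟ᵛ e ] * coeff q (e ∸ᵛ f))
coeff-single-*P c f q e = trans (coeff-*P ((c , f) ∷ []) q e) (+-identityʳ _)

varP-≡ : (j : Fin m) → varP j ≡ (1 , incAt j 0ᵛ) ∷ []
varP-≡ j = cong (λ v → (1 , v) ∷ [])
  (trans (sym (Vecₚ.tabulate∘lookup (exponentOf (varP j))))
         (trans (Vecₚ.tabulate-cong (lookup-exponentOf-varP j)) (Vecₚ.tabulate∘lookup (incAt j 0ᵛ))))
  where
  exponentOf : ∀ {m} → Poly m → Mono m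
  exponentOf []      = 0ᵛ
  exponentOf (t ∷ _) = proj₂ t
  -- varP builds its exponent with a helper local to Defs that cannot be named here;
  -- lookup-≡tabulate recovers it by unification.
  lookup-≡tabulate : ∀ {m} {f : Fin m → ℕ} (v : Vec ℕ m) → v ≡ tabulate f → ∀ k → lookup v k ≡ f k
  lookup-≡tabulate v refl = Vecₚ.lookup∘tabulate _
  lookup-exponentOf-varP : ∀ {m} (j k : Fin m) → lookup (exponentOf (varP j)) k ≡ lookup (incAt j 0ᵛ) k
  lookup-exponentOf-varP j k rewrite lookup-≡tabulate (exponentOf (varP j)) refl k with j ≟F k
  ... | yes refl = sym (trans (lookup-incAt j 0ᵛ) (cong suc (Vecₚ.lookup-replicate j 0)))
  ... | no j≢k   = sym (trans (Vecₚ.lookup∘updateAt′ k j (j≢k ∘ sym) 0ᵛ) (Vecₚ.lookup-replicate k 0))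

coeff-varP : (j : Fin m) (e : Mono m) → coeff (varP j) e ≡ [ incAt j 0ᵛ ≟ᵛ e ]
coeff-varP j e = trans (cong (λ p → coeff p e) (varP-≡ j)) (trans (coeff-single 1 (incAt j 0ᵛ) e) (*-identityˡ _))

coeff-varP-*P : (j : Fin m) (q : Poly m) (e : Mono m) →
                coeff (varP j *P q) e ≡ [ incAt j (decAt j e) ≟ᵛ e ] * coeff q (decAt j e)
coeff-varP-*P j q e = begin
  coeff (varP j *P q) e
    ≡⟨ cong (λ p → coeff (p *P q) e) (varP-≡ j) ⟩
  coeff (((1 , incAt j 0ᵛ) ∷ []) *P q) e
    ≡⟨ coeff-single-*P 1 (incAt j 0ᵛ) q e ⟩
  1 * ([ incAt j 0ᵛ +ᵛ (e ∸ᵛ incAt j 0ᵛ) ≟ᵛ e ] * coeff q (e ∸ᵛ incAt j 0ᵛ))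
    ≡⟨ *-identityˡ _ ⟩
  [ incAt j 0ᵛ +ᵛ (e ∸ᵛ incAt j 0ᵛ) ≟ᵛ e ] * coeff q (e ∸ᵛ incAt j 0ᵛ)
    ≡⟨ cong (λ f → [ incAt j 0ᵛ +ᵛ f ≟ᵛ e ] * coeff q f) (∸ᵛ-incAt-0ᵛ j e) ⟩
  [ incAt j 0ᵛ +ᵛ decAt j e ≟ᵛ e ] * coeff q (decAt j e)
    ≡⟨ cong (λ f → [ f ≟ᵛ e ] * coeff q (decAt j e)) (incAt-0ᵛ-+ᵛ j (decAt j e)) ⟩
  [ incAt j (decAt j e) ≟ᵛ e ] * coeff q (decAt j e) ∎
  where open ≡-Reasoning

coeff-varP-*P-suc : (j : Fin m) (q : Poly m) (e : Mono m) {k : ℕ} → lookup e j ≡ suc k →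
                    coeff (varP j *P q) e ≡ coeff q (decAt j e)
coeff-varP-*P-suc j q e eⱼ≡1+k = trans (coeff-varP-*P j q e)
  (trans (cong (_* coeff q (decAt j e)) ([]-yes (incAt j (decAt j e) ≟ᵛ e) (incAt-decAt j e eⱼ≡1+k))) (+-identityʳ _))

coeff-varP-*P-zero : (j : Fin m) (q : Poly m) (e : Mono m) → lookup e j ≡ 0 → coeff (varP j *P q) e ≡ 0
coeff-varP-*P-zero j q e eⱼ≡0 = trans (coeff-varP-*P j q e)
  (cong (_* coeff q (decAt j e)) ([]-no (incAt j (decAt j e) ≟ᵛ e) e⁻⁺≢e))
  where
  e⁻⁺≢e : incAt j (decAt j e) ≢ e
  e⁻⁺≢e e⁻⁺≡e = 0≢1+n (trans (sym eⱼ≡0) (trans (cong (λ f → lookup f j) (sym e⁻⁺≡e)) (lookup-incAt j (decAt j e))))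

coeff-euler : (j : Fin m) (p : Poly m) (e : Mono m) → coeff (varP j *P ∂ j p) e ≡ lookup e j * coeff p e
coeff-euler j p e with lookup e j in eⱼ≡
... | zero  = coeff-varP-*P-zero j (∂ j p) e eⱼ≡
... | suc k = begin
  coeff (varP j *P ∂ j p) e                          ≡⟨ coeff-varP-*P-suc j (∂ j p) e eⱼ≡ ⟩
  coeff (∂ j p) (decAt j e)                          ≡⟨ coeff-∂ j p (decAt j e) ⟩
  suc (lookup (decAt j e) j) * coeff p (incAt j (decAt j e))
    ≡⟨ cong₂ (λ a f → suc a * coeff p f) (trans (lookup-decAt j e) (cong pred eⱼ≡)) (incAt-decAt j e eⱼ≡) ⟩
  suc k * coeff p e                                  ∎
  where open ≡-Reasoning

∂-varP-self : (j : Fin m) → ∂ j (varP j) ≋ oneP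
∂-varP-self j = mk≋ λ e → begin
  coeff (∂ j (varP j)) e                                ≡⟨ coeff-∂ j (varP j) e ⟩
  suc (lookup e j) * coeff (varP j) (incAt j e)         ≡⟨ cong (suc (lookup e j) *_) (coeff-varP j (incAt j e)) ⟩
  suc (lookup e j) * [ incAt j 0ᵛ ≟ᵛ incAt j e ]        ≡⟨ pointwise e (0ᵛ ≟ᵛ e) ⟩
  1 * [ 0ᵛ ≟ᵛ e ]                                       ≡⟨ coeff-single 1 0ᵛ e ⟨
  coeff oneP e                                          ∎
  where
  open ≡-Reasoning
  pointwise : ∀ e → Dec (0ᵛ ≡ e) → suc (lookup e j) * [ incAt j 0ᵛ ≟ᵛ incAt j e ] ≡ 1 * [ 0ᵛ ≟ᵛ e ]
  pointwise e (yes refl) = trans (cong₂ (λ a b → suc a * b) (Vecₚ.lookup-replicate j 0) ([]-yes (incAt j 0ᵛ ≟ᵛ incAt j 0ᵛ) refl))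
                            (cong (1 *_) (sym ([]-yes (0ᵛ ≟ᵛ 0ᵛ) refl)))
  pointwise e (no 0≢e)   = trans (cong (suc (lookup e j) *_) ([]-no (incAt j 0ᵛ ≟ᵛ incAt j e) (0≢e ∘ incAt-injective j)))
                            (trans (*-zeroʳ (suc (lookup e j))) (cong (1 *_) (sym ([]-no (0ᵛ ≟ᵛ e) 0≢e))))

∂-varP-other : {i j : Fin m} → i ≢ j → ∂ i (varP j) ≋ zeroP
∂-varP-other {i = i} {j} i≢j = mk≋ λ e → begin
  coeff (∂ i (varP j)) e                          ≡⟨ coeff-∂ i (varP j) e ⟩
  suc (lookup e i) * coeff (varP j) (incAt i e)   ≡⟨ cong (suc (lookup e i) *_) (coeff-varP j (incAt i e)) ⟩
  suc (lookup e i) * [ incAt j 0ᵛ ≟ᵛ incAt i e ]  ≡⟨ cong (suc (lookup e i) *_) ([]-no (incAt j 0ᵛ ≟ᵛ incAt i e) (0≢1+n ∘ lookup-at-i e)) ⟩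
  suc (lookup e i) * 0                            ≡⟨ *-zeroʳ (suc (lookup e i)) ⟩
  0                                               ∎
  where
  open ≡-Reasoning
  lookup-at-i : ∀ e → incAt j 0ᵛ ≡ incAt i e → 0 ≡ suc (lookup e i)
  lookup-at-i e eq = trans (sym (trans (Vecₚ.lookup∘updateAt′ i j i≢j 0ᵛ) (Vecₚ.lookup-replicate i 0)))
                      (trans (cong (λ f → lookup f i) eq) (lookup-incAt i e))

sum-tabulate-lookup-* : (e : Mono m) (c : ℕ) → sum (tabulate (λ i → lookup e i * c)) ≡ sum e * c
sum-tabulate-lookup-* []      c = refl
sum-tabulate-lookup-* (b ∷ e) c = trans (cong (b * c +_) (sum-tabulate-lookup-* e c)) (sym (*-distribʳ-+ c b (sum e)))

coeff-ΣF : ∀ r (f : Fin r → Poly m) (e : Mono m) → coeff (ΣF r f) e ≡ sum (tabulate (λ i → coeff (f i) e))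
coeff-ΣF zero    f e = refl
coeff-ΣF (suc r) f e = trans (coeff-+P (f fzero) (ΣF r (f ∘ fsuc)) e) (cong (coeff (f fzero) e +_) (coeff-ΣF r (f ∘ fsuc) e))

module _ {m : ℕ} where
  open PolySolver {m}

  varP-*P-∂-^P : (j : Fin m) (n : ℕ) → varP j *P ∂ j (varP j ^P n) ≋ natP n *P varP j ^P n
  varP-*P-∂-^P j zero    = ≋-trans (*P-congˡ (varP j) (D-one (∂-isDerivation j))) (solve 1 (λ x → x :* con 0 := con 0) ≋-refl (varP j))
  varP-*P-∂-^P j (suc n) = begin
    x *P ∂ j (x *P x ^P n)                     ≈⟨ *P-congˡ x (∂-leibniz j x (x ^P n)) ⟩
    x *P (∂ j x *P x ^P n +P x *P ∂ j X)       ≈⟨ *P-congˡ x (+P-congʳ (x *P ∂ j X) (*P-congʳ (x ^P n) (∂-varP-self j))) ⟩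
    x *P (oneP *P x ^P n +P x *P ∂ j X)
      ≈⟨ solve 3 (λ x X x∂X → x :* (con 1 :* X :+ x∂X) := x :* X :+ x∂X :* x) ≋-refl x X (x *P ∂ j X) ⟩
    x *P X +P (x *P ∂ j X) *P x                ≈⟨ +P-congˡ (x *P X) (*P-congʳ x (varP-*P-∂-^P j n)) ⟩
    x *P X +P (natP n *P X) *P x
      ≈⟨ solve 3 (λ x X N → x :* X :+ (N :* X) :* x := (con 1 :+ N) :* (x :* X)) ≋-refl x X (natP n) ⟩
    natP (suc n) *P (x *P X)                   ∎
    where
    open ≋-Reasoning
    x = varP j
    X = varP j ^P n

  ΣF-cong : ∀ r {f g : Fin r → Poly m} → (∀ i → f i ≋ g i) → ΣF r f ≋ ΣF r g
  ΣF-cong zero    f≋g = ≋-refl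
  ΣF-cong (suc r) f≋g = +P-cong (f≋g fzero) (ΣF-cong r (f≋g ∘ fsuc))

  ΣF-zero : ∀ r (f : Fin r → Poly m) → (∀ i → f i ≋ zeroP) → ΣF r f ≋ zeroP
  ΣF-zero zero    f f≋0 = ≋-refl
  ΣF-zero (suc r) f f≋0 = +P-cong (f≋0 fzero) (ΣF-zero r (f ∘ fsuc) (f≋0 ∘ fsuc))

  ΣF-+ : ∀ r (f g : Fin r → Poly m) → ΣF r (λ i → f i +P g i) ≋ ΣF r f +P ΣF r g
  ΣF-+ zero    f g = ≋-refl
  ΣF-+ (suc r) f g = ≋-trans (+P-congˡ (f fzero +P g fzero) (ΣF-+ r (f ∘ fsuc) (g ∘ fsuc)))
    (solve 4 (λ a b c d → (a :+ b) :+ (c :+ d) := (a :+ c) :+ (b :+ d)) ≋-refl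
      (f fzero) (g fzero) (ΣF r (f ∘ fsuc)) (ΣF r (g ∘ fsuc)))

  ΣF-*ˡ : ∀ r (c : Poly m) (f : Fin r → Poly m) → ΣF r (λ i → c *P f i) ≋ c *P ΣF r f
  ΣF-*ˡ zero    c f = solve 1 (λ c → con 0 := c :* con 0) ≋-refl c
  ΣF-*ˡ (suc r) c f = ≋-trans (+P-congˡ (c *P f fzero) (ΣF-*ˡ r c (f ∘ fsuc)))
    (solve 3 (λ c a b → c :* a :+ c :* b := c :* (a :+ b)) ≋-refl c (f fzero) (ΣF r (f ∘ fsuc)))

  ΣF-*ʳ : ∀ r (c : Poly m) (f : Fin r → Poly m) → ΣF r (λ i → f i *P c) ≋ ΣF r f *P c
  ΣF-*ʳ r c f = ≋-trans (ΣF-cong r (λ i → *P-comm (f i) c)) (≋-trans (ΣF-*ˡ r c f) (*P-comm c (ΣF r f)))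

-- Complete homogeneous symmetric polynomials

∑-upTo-[≟] : ∀ n b (G : ℕ → ℕ) → ∑ (upTo n) (λ j → [ j ≟ b ] * G j) ≡ [ b <? n ] * G b
∑-upTo-[≟] zero    b G = refl
∑-upTo-[≟] (suc n) b G = begin
  ∑ (upTo (suc n)) F                          ≡⟨ cong (λ js → ∑ js F) (Listₚ.upTo-∷ʳ n) ⟨
  ∑ (upTo n ∷ʳ n) F                           ≡⟨ ∑-++ (upTo n) (n ∷ []) F ⟩
  ∑ (upTo n) F + (F n + 0)                    ≡⟨ cong₂ _+_ (∑-upTo-[≟] n b G) (+-identityʳ (F n)) ⟩
  [ b <? n ] * G b + [ n ≟ b ] * G n          ≡⟨ cong ([ b <? n ] * G b +_) ([m≟n]*G[m]≡[m≟n]*G[n] n b G) ⟩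
  [ b <? n ] * G b + [ n ≟ b ] * G b          ≡⟨ *-distribʳ-+ (G b) [ b <? n ] [ n ≟ b ] ⟨
  ([ b <? n ] + [ n ≟ b ]) * G b              ≡⟨ cong (_* G b) ([m<?1+n]≡[m<?n]+[n≟m] b n) ⟨
  [ b <? suc n ] * G b                        ∎
  where
  open ≡-Reasoning
  F : ℕ → ℕ
  F j = [ j ≟ b ] * G j

expVecs-suc : ∀ d r → expVecs d (suc r) ≡ concatMap (λ j → map (j ∷_) (expVecs (d ∸ j) r)) (upTo (suc d))
expVecs-suc zero    r = refl
expVecs-suc (suc d) r = refl

∑-expVecs : ∀ d r (e : Vec ℕ r) → ∑ (expVecs d r) (λ v → [ v ≟ᵛ e ]) ≡ [ sum e ≟ d ]
∑-expVecs zero    zero    [] = refl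
∑-expVecs (suc d) zero    [] = refl
∑-expVecs d       (suc r) (b ∷ e) = begin
  ∑ (expVecs d (suc r)) F                                    ≡⟨ cong (λ vs → ∑ vs F) (expVecs-suc d r) ⟩
  ∑ (concatMap withHead (upTo (suc d))) F                    ≡⟨ ∑-concatMap withHead (upTo (suc d)) F ⟩
  ∑ (upTo (suc d)) (λ j → ∑ (withHead j) F)                  ≡⟨ ∑-cong (upTo (suc d)) ∑-withHead ⟩
  ∑ (upTo (suc d)) (λ j → [ j ≟ b ] * [ sum e ≟ d ∸ j ])     ≡⟨ ∑-upTo-[≟] (suc d) b _ ⟩
  [ b <? suc d ] * [ sum e ≟ d ∸ b ]                         ≡⟨ []-×-dec (b <? suc d) (sum e ≟ d ∸ b) ⟨
  [ b <? suc d ×-dec sum e ≟ d ∸ b ]                         ≡⟨ []-cong _ (b + sum e ≟ d) join split ⟩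
  [ b + sum e ≟ d ]                                          ∎
  where
  open ≡-Reasoning
  F : Vec ℕ (suc r) → ℕ
  F v = [ v ≟ᵛ b ∷ e ]
  withHead : ℕ → List (Vec ℕ (suc r))
  withHead j = map (j ∷_) (expVecs (d ∸ j) r)
  ∑-withHead : ∀ j → ∑ (withHead j) F ≡ [ j ≟ b ] * [ sum e ≟ d ∸ j ]
  ∑-withHead j = begin
    ∑ (map (j ∷_) (expVecs (d ∸ j) r)) F                 ≡⟨ ∑-map (j ∷_) (expVecs (d ∸ j) r) F ⟩
    ∑ (expVecs (d ∸ j) r) (λ v → [ j ∷ v ≟ᵛ b ∷ e ])     ≡⟨ ∑-cong (expVecs (d ∸ j) r) (λ v → []-∷ j b v e) ⟩
    ∑ (expVecs (d ∸ j) r) (λ v → [ j ≟ b ] * [ v ≟ᵛ e ]) ≡⟨ ∑-*ˡ (expVecs (d ∸ j) r) [ j ≟ b ] _ ⟩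
    [ j ≟ b ] * ∑ (expVecs (d ∸ j) r) (λ v → [ v ≟ᵛ e ]) ≡⟨ cong ([ j ≟ b ] *_) (∑-expVecs (d ∸ j) r e) ⟩
    [ j ≟ b ] * [ sum e ≟ d ∸ j ]                        ∎
  join : b < suc d Prod.× sum e ≡ d ∸ b → b + sum e ≡ d
  join (b<1+d , Σe≡d∸b) = trans (cong (b +_) Σe≡d∸b) (m+[n∸m]≡n (s≤s⁻¹ b<1+d))
  split : b + sum e ≡ d → b < suc d Prod.× sum e ≡ d ∸ b
  split refl = s≤s (m≤m+n b (sum e)) , sym (m+n∸m≡n b (sum e))

coeff-hP : ∀ r d a (e : Vec ℕ r) → coeff (hP r d) (a ∷ e) ≡ [ 0 ≟ a ] * [ sum e ≟ d ]
coeff-hP r d a e = begin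
  coeff (hP r d) (a ∷ e)                                   ≡⟨ coeff-∑ (hP r d) (a ∷ e) ⟩
  ∑ (hP r d) (contrib (a ∷ e))                             ≡⟨ ∑-map _ (expVecs d r) (contrib (a ∷ e)) ⟩
  ∑ (expVecs d r) (λ v → 1 * [ 0 ∷ v ≟ᵛ a ∷ e ])           ≡⟨ ∑-cong (expVecs d r) (λ v → trans (*-identityˡ _) ([]-∷ 0 a v e)) ⟩
  ∑ (expVecs d r) (λ v → [ 0 ≟ a ] * [ v ≟ᵛ e ])           ≡⟨ ∑-*ˡ (expVecs d r) [ 0 ≟ a ] _ ⟩
  [ 0 ≟ a ] * ∑ (expVecs d r) (λ v → [ v ≟ᵛ e ])           ≡⟨ cong ([ 0 ≟ a ] *_) (∑-expVecs d r e) ⟩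
  [ 0 ≟ a ] * [ sum e ≟ d ]                                ∎
  where open ≡-Reasoning

module _ (r : ℕ) where
  open PolySolver {suc r}

  hP-zero : hP r 0 ≋ oneP
  hP-zero = mk≋ λ { (a ∷ e) → pointwise a e }
    where
    open ≡-Reasoning
    pointwise : ∀ a e → coeff (hP r 0) (a ∷ e) ≡ coeff oneP (a ∷ e)
    pointwise a e = begin
      coeff (hP r 0) (a ∷ e)           ≡⟨ coeff-hP r 0 a e ⟩
      [ 0 ≟ a ] * [ sum e ≟ 0 ]        ≡⟨ cong ([ 0 ≟ a ] *_) ([]-cong (sum e ≟ 0) (0ᵛ ≟ᵛ e) (sym ∘ sum≡0⇒≡0ᵛ e) λ { refl → sum-0ᵛ {r} }) ⟩
      [ 0 ≟ a ] * [ 0ᵛ ≟ᵛ e ]          ≡⟨ []-∷ 0 a 0ᵛ e ⟨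
      [ 0 ∷ 0ᵛ ≟ᵛ a ∷ e ]              ≡⟨ *-identityˡ _ ⟨
      1 * [ 0 ∷ 0ᵛ ≟ᵛ a ∷ e ]          ≡⟨ coeff-single 1 0ᵛ (a ∷ e) ⟨
      coeff oneP (a ∷ e)               ∎

  ∂y-hP : ∀ d → ∂ fzero (hP r d) ≋ zeroP
  ∂y-hP d = mk≋ λ { (a ∷ e) → begin
      coeff (∂ fzero (hP r d)) (a ∷ e)           ≡⟨ coeff-∂ fzero (hP r d) (a ∷ e) ⟩
      suc a * coeff (hP r d) (suc a ∷ e)         ≡⟨ cong (suc a *_) (coeff-hP r d (suc a) e) ⟩
      suc a * ([ 0 ≟ suc a ] * [ sum e ≟ d ])    ≡⟨ cong (λ z → suc a * (z * [ sum e ≟ d ])) ([]-no (0 ≟ suc a) 0≢1+n) ⟩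
      suc a * 0                                  ≡⟨ *-zeroʳ (suc a) ⟩
      0                                          ∎ }
    where open ≡-Reasoning

  ∂-hP-suc : ∀ i d → ∂ (fsuc i) (hP r (suc d)) ≋ hP r d +P xP i *P ∂ (fsuc i) (hP r d)
  ∂-hP-suc i d = mk≋ λ { (a ∷ e) → begin
      coeff (∂ (fsuc i) (hP r (suc d))) (a ∷ e)                ≡⟨ coeff-∂ (fsuc i) (hP r (suc d)) (a ∷ e) ⟩
      suc (lookup e i) * coeff (hP r (suc d)) (a ∷ incAt i e)  ≡⟨ cong (suc (lookup e i) *_) (coeff-hP r (suc d) a (incAt i e)) ⟩
      suc (lookup e i) * ([ 0 ≟ a ] * [ sum (incAt i e) ≟ suc d ])
        ≡⟨ cong (λ s → suc (lookup e i) * ([ 0 ≟ a ] * [ s ≟ suc d ])) (sum-incAt i e) ⟩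
      suc (lookup e i) * ([ 0 ≟ a ] * [ suc (sum e) ≟ suc d ])
        ≡⟨ cong (λ z → suc (lookup e i) * ([ 0 ≟ a ] * z)) ([1+m≟1+n]≡[m≟n] (sum e) d) ⟩
      suc (lookup e i) * ([ 0 ≟ a ] * [ sum e ≟ d ])
        ≡⟨ cong₂ (λ u v → u + lookup e i * v) (coeff-hP r d a e) (coeff-hP r d a e) ⟨
      coeff (hP r d) (a ∷ e) + lookup e i * coeff (hP r d) (a ∷ e)
        ≡⟨ cong (coeff (hP r d) (a ∷ e) +_) (coeff-euler (fsuc i) (hP r d) (a ∷ e)) ⟨
      coeff (hP r d) (a ∷ e) + coeff (xP i *P ∂ (fsuc i) (hP r d)) (a ∷ e)
        ≡⟨ coeff-+P (hP r d) (xP i *P ∂ (fsuc i) (hP r d)) (a ∷ e) ⟨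
      coeff (hP r d +P xP i *P ∂ (fsuc i) (hP r d)) (a ∷ e)    ∎ }
    where open ≡-Reasoning

  euler-hP : ∀ d → ΣF r (λ i → xP i *P ∂ (fsuc i) (hP r d)) ≋ natP d *P hP r d
  euler-hP d = mk≋ λ { (a ∷ e) → begin
      coeff (ΣF r (λ i → xP i *P ∂ (fsuc i) (hP r d))) (a ∷ e)
        ≡⟨ coeff-ΣF r _ (a ∷ e) ⟩
      sum (tabulate (λ i → coeff (xP i *P ∂ (fsuc i) (hP r d)) (a ∷ e)))
        ≡⟨ cong sum (Vecₚ.tabulate-cong (λ i → coeff-euler (fsuc i) (hP r d) (a ∷ e))) ⟩
      sum (tabulate (λ i → lookup e i * coeff (hP r d) (a ∷ e)))
        ≡⟨ sum-tabulate-lookup-* e _ ⟩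
      sum e * coeff (hP r d) (a ∷ e)
        ≡⟨ cong (sum e *_) (coeff-hP r d a e) ⟩
      sum e * ([ 0 ≟ a ] * [ sum e ≟ d ])
        ≡⟨ x∙yz≈y∙xz (sum e) [ 0 ≟ a ] _ ⟩
      [ 0 ≟ a ] * (sum e * [ sum e ≟ d ])
        ≡⟨ cong ([ 0 ≟ a ] *_) (degree (sum e)) ⟩
      [ 0 ≟ a ] * (d * [ sum e ≟ d ])
        ≡⟨ x∙yz≈y∙xz d [ 0 ≟ a ] _ ⟨
      d * ([ 0 ≟ a ] * [ sum e ≟ d ])
        ≡⟨ cong (d *_) (coeff-hP r d a e) ⟨
      d * coeff (hP r d) (a ∷ e)
        ≡⟨ coeff-natP-*P d (hP r d) (a ∷ e) ⟨
      coeff (natP d *P hP r d) (a ∷ e) ∎ }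
    where
    open ≡-Reasoning
    degree : ∀ s → s * [ s ≟ d ] ≡ d * [ s ≟ d ]
    degree s = trans (*-comm s _) (trans ([m≟n]*G[m]≡[m≟n]*G[n] s d (λ x → x)) (*-comm _ d))

  Dminus-coefficient : Fin r → Poly (suc r)
  Dminus-coefficient i = xP i *P xP i +P xP i *P sumX r

  Dminus-isDerivation : IsDerivation (Dminus r)
  Dminus-isDerivation = ΣF-isDerivation r Dminus-coefficient (λ i → ∂ (fsuc i)) (λ i → ∂-isDerivation (fsuc i))

  Dminus-y : Dminus r yP ≋ zeroP
  Dminus-y = ΣF-zero r (λ i → c i *P ∂ (fsuc i) yP) λ i →
    ≋-trans (*P-congˡ (c i) (∂-varP-other {i = fsuc i} {j = fzero} (λ ()))) (solve 1 (λ c → c :* con 0 := con 0) ≋-refl (c i))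
    where c = Dminus-coefficient

  -- The identity for D⁻_r h_d of the header, with (Σ x_i) h_d moved left to avoid d − 1.
  Dminus-hP : ∀ d → Dminus r (hP r d) +P sumX r *P hP r d ≋ natP (suc d) *P hP r (suc d) +P natP d *P (sumX r *P hP r d)
  Dminus-hP d = begin
    Dminus r h +P S *P h
      ≈⟨ +P-congˡ (Dminus r h) (ΣF-*ʳ r h xP) ⟨
    ΣF r (λ i → (xP i *P xP i +P xP i *P S) *P ∂x i h) +P ΣF r (λ i → xP i *P h)
      ≈⟨ ΣF-+ r _ _ ⟨
    ΣF r (λ i → (xP i *P xP i +P xP i *P S) *P ∂x i h +P xP i *P h)
      ≈⟨ ΣF-cong r regroup ⟩
    ΣF r (λ i → xP i *P ∂x i (hP r (suc d)) +P S *P (xP i *P ∂x i h))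
      ≈⟨ ΣF-+ r _ _ ⟩
    ΣF r (λ i → xP i *P ∂x i (hP r (suc d))) +P ΣF r (λ i → S *P (xP i *P ∂x i h))
      ≈⟨ +P-congˡ (ΣF r (λ i → xP i *P ∂x i (hP r (suc d)))) (ΣF-*ˡ r S _) ⟩
    ΣF r (λ i → xP i *P ∂x i (hP r (suc d))) +P S *P ΣF r (λ i → xP i *P ∂x i h)
      ≈⟨ +P-cong (euler-hP (suc d)) (*P-congˡ S (euler-hP d)) ⟩
    natP (suc d) *P hP r (suc d) +P S *P (natP d *P h)
      ≈⟨ +P-congˡ (natP (suc d) *P hP r (suc d)) (solve 3 (λ s n h → s :* (n :* h) := n :* (s :* h)) ≋-refl S (natP d) h) ⟩
    natP (suc d) *P hP r (suc d) +P natP d *P (S *P h) ∎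
    where
    open ≋-Reasoning
    S = sumX r
    h = hP r d
    ∂x : Fin r → Poly (suc r) → Poly (suc r)
    ∂x i = ∂ (fsuc i)
    regroup : ∀ i → (xP i *P xP i +P xP i *P S) *P ∂x i h +P xP i *P h ≋ xP i *P ∂x i (hP r (suc d)) +P S *P (xP i *P ∂x i h)
    regroup i = begin
      (xP i *P xP i +P xP i *P S) *P ∂x i h +P xP i *P h
        ≈⟨ solve 4 (λ x s q h → (x :* x :+ x :* s) :* q :+ x :* h := x :* (h :+ x :* q) :+ s :* (x :* q)) ≋-refl (xP i) S (∂x i h) h ⟩
      xP i *P (h +P xP i *P ∂x i h) +P S *P (xP i *P ∂x i h)
        ≈⟨ +P-congʳ (S *P (xP i *P ∂x i h)) (*P-congˡ (xP i) (∂-hP-suc i d)) ⟨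
      xP i *P ∂x i (hP r (suc d)) +P S *P (xP i *P ∂x i h) ∎

-- Increasing forests

module _ {m : ℕ} where
  open PolySolver {m}

  sumP-++ : (ps qs : List (Poly m)) → sumP (ps ++ qs) ≋ sumP ps +P sumP qs
  sumP-++ ps qs = ≡⇒≋ (sym (Listₚ.concat-++ ps qs))

  sumP-map-++ : (g : A → Poly m) (xs ys : List A) → sumP (map g (xs ++ ys)) ≋ sumP (map g xs) +P sumP (map g ys)
  sumP-map-++ g xs ys = ≋-trans (≡⇒≋ (cong sumP (Listₚ.map-++ g xs ys))) (sumP-++ (map g xs) (map g ys))

  sumP-map-∘ : (g : A → Poly m) (h : B → A) (xs : List B) → sumP (map g (map h xs)) ≋ sumP (map (g ∘ h) xs)
  sumP-map-∘ g h xs = ≡⇒≋ (cong sumP (sym (Listₚ.map-∘ xs)))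

  sumP-concatMap : (g : A → Poly m) (h : B → List A) (xs : List B) →
                   sumP (map g (concatMap h xs)) ≋ sumP (map (λ x → sumP (map g (h x))) xs)
  sumP-concatMap g h []       = ≋-refl
  sumP-concatMap g h (x ∷ xs) = ≋-trans (sumP-map-++ g (h x) (concatMap h xs)) (+P-congˡ (sumP (map g (h x))) (sumP-concatMap g h xs))

  sumP-cong : {g h : A → Poly m} (xs : List A) → (∀ x → g x ≋ h x) → sumP (map g xs) ≋ sumP (map h xs)
  sumP-cong []       g≋h = ≋-refl
  sumP-cong (x ∷ xs) g≋h = +P-cong (g≋h x) (sumP-cong xs g≋h)

  sumP-+ : (g h : A → Poly m) (xs : List A) → sumP (map (λ x → g x +P h x) xs) ≋ sumP (map g xs) +P sumP (map h xs)
  sumP-+ g h []       = ≋-refl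
  sumP-+ g h (x ∷ xs) = ≋-trans (+P-congˡ (g x +P h x) (sumP-+ g h xs))
    (solve 4 (λ a b c d → (a :+ b) :+ (c :+ d) := (a :+ c) :+ (b :+ d)) ≋-refl (g x) (h x) (sumP (map g xs)) (sumP (map h xs)))

  sumP-*ˡ : (c : Poly m) (g : A → Poly m) (xs : List A) → sumP (map (λ x → c *P g x) xs) ≋ c *P sumP (map g xs)
  sumP-*ˡ c g []       = solve 1 (λ c → con 0 := c :* con 0) ≋-refl c
  sumP-*ˡ c g (x ∷ xs) = ≋-trans (+P-congˡ (c *P g x) (sumP-*ˡ c g xs))
    (solve 3 (λ c a b → c :* a :+ c :* b := c :* (a :+ b)) ≋-refl c (g x) (sumP (map g xs)))

  sumP-*ʳ : (c : Poly m) (g : A → Poly m) (xs : List A) → sumP (map (λ x → g x *P c) xs) ≋ sumP (map g xs) *P c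
  sumP-*ʳ c g xs = ≋-trans (sumP-cong xs (λ x → *P-comm (g x) c)) (≋-trans (sumP-*ˡ c g xs) (*P-comm c (sumP (map g xs))))

  sumP-length : (G : ℕ → Poly m) (g : List A → Poly m) (n : ℕ) (ls : List (List A)) → All (λ l → length l ≡ n) ls →
                sumP (map (λ l → G (length l) *P g l) ls) ≋ G n *P sumP (map g ls)
  sumP-length G g n []       []             = solve 1 (λ c → con 0 := c :* con 0) ≋-refl (G n)
  sumP-length G g n (l ∷ ls) (refl ∷ ls≡n) = ≋-trans (+P-congˡ (G n *P g l) (sumP-length G g n ls ls≡n))
    (solve 3 (λ c a b → c :* a :+ c :* b := c :* (a :+ b)) ≋-refl (G n) (g l) (sumP (map g ls)))

module LahRecurrence
  {r : ℕ} (φ : ℕ → Poly (suc r)) (S : Poly (suc r))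
  {E : Poly (suc r) → Poly (suc r)} (E-isDerivation : IsDerivation E)
  (φ-zero : φ 0 ≋ oneP)
  (E-φ : ∀ d → E (φ d) +P S *P φ d ≋ natP (suc d) *P φ (suc d) +P natP d *P (S *P φ d))
  (∂y-φ : ∀ d → ∂ fzero (φ d) ≋ zeroP)
  (E-y : E yP ≋ zeroP)
  where

  open PolySolver {suc r}
  open ≋-Reasoning

  Ẽ : Poly (suc r) → Poly (suc r)
  Ẽ p = E p +P S *P yP *P ∂ fzero p

  Ẽ-isDerivation : IsDerivation Ẽ
  Ẽ-isDerivation = +-isDerivation E-isDerivation (*-isDerivation (S *P yP) (∂-isDerivation fzero))

  leaf-weight : ∀ k → wT φ (node k []) ≋ oneP
  leaf-weight k = ≋-trans (*P-congʳ oneP φ-zero) (*P-identityˡ oneP)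

  sumP-insHere : (ψ : ℕ → Poly (suc r)) (k : ℕ) (cs : List Tree) →
                 sumP (map (λ l → ψ (length l) *P wF φ l) (insHere k cs))
                   ≋ natP (suc (length cs)) *P (ψ (suc (length cs)) *P wF φ cs)
  sumP-insHere ψ k [] = begin
    ψ 1 *P (wT φ (node k []) *P oneP) +P zeroP    ≈⟨ +P-congʳ zeroP (*P-congˡ (ψ 1) (*P-congʳ oneP (leaf-weight k))) ⟩
    ψ 1 *P (oneP *P oneP) +P zeroP
      ≈⟨ solve 1 (λ a → a :* (con 1 :* con 1) :+ con 0 := (con 1 :+ con 0) :* (a :* con 1)) ≋-refl (ψ 1) ⟩
    natP 1 *P (ψ 1 *P oneP)                       ∎
  sumP-insHere ψ k (c ∷ cs) = begin
    ψ₂ *P (wT φ (node k []) *P w) +P sumP (map (λ l → ψ (length l) *P wF φ l) (map (c ∷_) (insHere k cs)))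
      ≈⟨ +P-cong (*P-congˡ ψ₂ (*P-congʳ w (leaf-weight k))) (sumP-map-∘ (λ l → ψ (length l) *P wF φ l) (c ∷_) (insHere k cs)) ⟩
    ψ₂ *P (oneP *P w) +P sumP (map (λ l → ψ (suc (length l)) *P (wT φ c *P wF φ l)) (insHere k cs))
      ≈⟨ +P-congˡ (ψ₂ *P (oneP *P w)) (sumP-cong (insHere k cs) λ l →
           solve 3 (λ a b c → a :* (b :* c) := b :* (a :* c)) ≋-refl (ψ (suc (length l))) (wT φ c) (wF φ l)) ⟩
    ψ₂ *P (oneP *P w) +P sumP (map (λ l → wT φ c *P (ψ (suc (length l)) *P wF φ l)) (insHere k cs))
      ≈⟨ +P-congˡ (ψ₂ *P (oneP *P w)) (sumP-*ˡ (wT φ c) (λ l → ψ (suc (length l)) *P wF φ l) (insHere k cs)) ⟩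
    ψ₂ *P (oneP *P w) +P wT φ c *P sumP (map (λ l → ψ (suc (length l)) *P wF φ l) (insHere k cs))
      ≈⟨ +P-congˡ (ψ₂ *P (oneP *P w)) (*P-congˡ (wT φ c) (sumP-insHere (ψ ∘ suc) k cs)) ⟩
    ψ₂ *P (oneP *P w) +P wT φ c *P (natP (suc n) *P (ψ₂ *P wF φ cs))
      ≈⟨ solve 4 (λ a b c N → a :* (con 1 :* (b :* c)) :+ b :* (N :* (a :* c)) := (con 1 :+ N) :* (a :* (b :* c))) ≋-refl
           ψ₂ (wT φ c) (wF φ cs) (natP (suc n)) ⟩
    natP (suc (suc n)) *P (ψ₂ *P w)               ∎
    where
    n = length cs
    ψ₂ = ψ (suc (suc n))
    w = wT φ c *P wF φ cs

  insBelow-length : ∀ k ts → All (λ l → length l ≡ length ts) (insBelow k ts)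
  insBelow-length k []       = []
  insBelow-length k (t ∷ ts) =
    ++⁺ (map⁺ (All.universal (λ _ → refl) (insT k t))) (map⁺ (All.map (cong suc) (insBelow-length k ts)))

  mutual
    sumP-insT : ∀ k t → sumP (map (wT φ) (insT k t)) ≋ E (wT φ t) +P S *P wT φ t
    sumP-insT k (node a cs) = begin
      sumP (map (wT φ) (map (node a) (insHere k cs ++ insBelow k cs)))
        ≈⟨ sumP-map-∘ (wT φ) (node a) (insHere k cs ++ insBelow k cs) ⟩
      sumP (map G (insHere k cs ++ insBelow k cs))
        ≈⟨ sumP-map-++ G (insHere k cs) (insBelow k cs) ⟩
      sumP (map G (insHere k cs)) +P sumP (map G (insBelow k cs))
        ≈⟨ +P-cong (sumP-insHere φ k cs) (sumP-length φ (wF φ) d (insBelow k cs) (insBelow-length k cs)) ⟩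
      natP (suc d) *P (φ (suc d) *P w) +P φ d *P sumP (map (wF φ) (insBelow k cs))
        ≈⟨ +P-congˡ (natP (suc d) *P (φ (suc d) *P w)) (*P-congˡ (φ d) (sumP-insBelow k cs)) ⟩
      natP (suc d) *P (φ (suc d) *P w) +P φ d *P (E w +P natP d *P (S *P w))
        ≈⟨ solve 7 (λ N₁ φ₁ w φ₀ Ew N s → N₁ :* (φ₁ :* w) :+ φ₀ :* (Ew :+ N :* (s :* w))
                     := (N₁ :* φ₁ :+ N :* (s :* φ₀)) :* w :+ φ₀ :* Ew) ≋-refl
             (natP (suc d)) (φ (suc d)) w (φ d) (E w) (natP d) S ⟩
      (natP (suc d) *P φ (suc d) +P natP d *P (S *P φ d)) *P w +P φ d *P E w
        ≈⟨ +P-congʳ (φ d *P E w) (*P-congʳ w (E-φ d)) ⟨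
      (E (φ d) +P S *P φ d) *P w +P φ d *P E w
        ≈⟨ solve 5 (λ Eφ s φ₀ w Ew → (Eφ :+ s :* φ₀) :* w :+ φ₀ :* Ew := (Eφ :* w :+ φ₀ :* Ew) :+ s :* (φ₀ :* w)) ≋-refl
             (E (φ d)) S (φ d) w (E w) ⟩
      (E (φ d) *P w +P φ d *P E w) +P S *P (φ d *P w)
        ≈⟨ +P-congʳ (S *P (φ d *P w)) (D-leibniz E-isDerivation (φ d) w) ⟨
      E (φ d *P w) +P S *P (φ d *P w) ∎
      where
      d = length cs
      w = wF φ cs
      G : List Tree → Poly (suc r)
      G l = φ (length l) *P wF φ l

    sumP-insBelow : ∀ k ts → sumP (map (wF φ) (insBelow k ts)) ≋ E (wF φ ts) +P natP (length ts) *P (S *P wF φ ts)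
    sumP-insBelow k []       = ≋-sym (≋-trans (+P-identityʳ (E oneP)) (D-one E-isDerivation))
    sumP-insBelow k (t ∷ ts) = begin
      sumP (map (wF φ) (map (_∷ ts) (insT k t) ++ map (t ∷_) (insBelow k ts)))
        ≈⟨ sumP-map-++ (wF φ) (map (_∷ ts) (insT k t)) (map (t ∷_) (insBelow k ts)) ⟩
      sumP (map (wF φ) (map (_∷ ts) (insT k t))) +P sumP (map (wF φ) (map (t ∷_) (insBelow k ts)))
        ≈⟨ +P-cong (sumP-map-∘ (wF φ) (_∷ ts) (insT k t)) (sumP-map-∘ (wF φ) (t ∷_) (insBelow k ts)) ⟩
      sumP (map (λ t′ → wT φ t′ *P w) (insT k t)) +P sumP (map (λ l → u *P wF φ l) (insBelow k ts))
        ≈⟨ +P-cong (sumP-*ʳ w (wT φ) (insT k t)) (sumP-*ˡ u (wF φ) (insBelow k ts)) ⟩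
      sumP (map (wT φ) (insT k t)) *P w +P u *P sumP (map (wF φ) (insBelow k ts))
        ≈⟨ +P-cong (*P-congʳ w (sumP-insT k t)) (*P-congˡ u (sumP-insBelow k ts)) ⟩
      (E u +P S *P u) *P w +P u *P (E w +P natP n *P (S *P w))
        ≈⟨ solve 6 (λ Eu s u w Ew N → (Eu :+ s :* u) :* w :+ u :* (Ew :+ N :* (s :* w))
                     := (Eu :* w :+ u :* Ew) :+ (con 1 :+ N) :* (s :* (u :* w))) ≋-refl
             (E u) S u w (E w) (natP n) ⟩
      (E u *P w +P u *P E w) +P natP (suc n) *P (S *P (u *P w))
        ≈⟨ +P-congʳ (natP (suc n) *P (S *P (u *P w))) (D-leibniz E-isDerivation u w) ⟨
      E (u *P w) +P natP (suc n) *P (S *P (u *P w)) ∎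
      where
      n = length ts
      u = wT φ t
      w = wF φ ts

  module _ {D : Poly (suc r) → Poly (suc r)} (D-isDerivation : IsDerivation D) (D-φ : ∀ d → D (φ d) ≋ zeroP) where
    mutual
      D-wT : ∀ t → D (wT φ t) ≋ zeroP
      D-wT (node a cs) = D-*P-zero D-isDerivation (D-φ (length cs)) (D-wF cs)

      D-wF : ∀ ts → D (wF φ ts) ≋ zeroP
      D-wF []       = D-one D-isDerivation
      D-wF (t ∷ ts) = D-*P-zero D-isDerivation (D-wT t) (D-wF ts)

  wF-++ : ∀ f g → wF φ (f ++ g) ≋ wF φ f *P wF φ g
  wF-++ []      g = ≋-sym (*P-identityˡ (wF φ g))
  wF-++ (t ∷ f) g = ≋-trans (*P-congˡ (wT φ t) (wF-++ f g)) (≋-sym (*P-assoc (wT φ t) (wF φ f) (wF φ g)))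

  weight : Forest → Poly (suc r)
  weight f = wF φ f *P yP ^P length f

  insF-weight : ∀ k f → sumP (map weight (insF k f)) ≋ Ẽ (weight f) +P yP *P weight f
  insF-weight k f = begin
    weight (f ++ node k [] ∷ []) +P sumP (map weight (insBelow k f))
      ≈⟨ +P-cong new-tree (≋-trans (sumP-cong (insBelow k f) (λ l → *P-comm (wF φ l) (yP ^P length l)))
                                   (sumP-length (yP ^P_) (wF φ) n (insBelow k f) (insBelow-length k f))) ⟩
    yP *P (w *P Y) +P Y *P sumP (map (wF φ) (insBelow k f))
      ≈⟨ +P-congˡ (yP *P (w *P Y)) (*P-congˡ Y (sumP-insBelow k f)) ⟩
    yP *P (w *P Y) +P Y *P (E w +P natP n *P (S *P w))
      ≈⟨ solve 6 (λ y w Y Ew N s → y :* (w :* Y) :+ Y :* (Ew :+ N :* (s :* w))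
                   := (Ew :* Y :+ s :* (N :* (w :* Y))) :+ y :* (w :* Y)) ≋-refl
           yP w Y (E w) (natP n) S ⟩
    (E w *P Y +P S *P (natP n *P (w *P Y))) +P yP *P (w *P Y)
      ≈⟨ +P-congʳ (yP *P (w *P Y)) (+P-cong E-wY (*P-congˡ S y∂y-wY)) ⟨
    (E (w *P Y) +P S *P (yP *P ∂ fzero (w *P Y))) +P yP *P (w *P Y)
      ≈⟨ solve 5 (λ Ew s y ∂w wY → (Ew :+ s :* (y :* ∂w)) :+ y :* wY := (Ew :+ s :* y :* ∂w) :+ y :* wY) ≋-refl
           (E (w *P Y)) S yP (∂ fzero (w *P Y)) (w *P Y) ⟩
    Ẽ (w *P Y) +P yP *P (w *P Y) ∎
    where
    n = length f
    w = wF φ f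
    Y = yP ^P n
    new-tree : weight (f ++ node k [] ∷ []) ≋ yP *P (w *P Y)
    new-tree = begin
      wF φ (f ++ node k [] ∷ []) *P yP ^P length (f ++ node k [] ∷ [])
        ≈⟨ ≡⇒≋ (cong (λ l → wF φ (f ++ node k [] ∷ []) *P yP ^P l) (trans (Listₚ.length-++ f) (+-comm n 1))) ⟩
      wF φ (f ++ node k [] ∷ []) *P (yP *P Y)
        ≈⟨ *P-congʳ (yP *P Y) (≋-trans (wF-++ f (node k [] ∷ [])) (*P-congˡ w (*P-congʳ oneP (leaf-weight k)))) ⟩
      w *P (oneP *P oneP) *P (yP *P Y)
        ≈⟨ solve 3 (λ w y Y → w :* (con 1 :* con 1) :* (y :* Y) := y :* (w :* Y)) ≋-refl w yP Y ⟩
      yP *P (w *P Y) ∎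
    E-wY : E (w *P Y) ≋ E w *P Y
    E-wY = begin
      E (w *P Y)                   ≈⟨ D-leibniz E-isDerivation w Y ⟩
      E w *P Y +P w *P E Y         ≈⟨ +P-congˡ (E w *P Y) (*P-congˡ w (D-^P E-isDerivation yP E-y n)) ⟩
      E w *P Y +P w *P zeroP       ≈⟨ solve 2 (λ a w → a :+ w :* con 0 := a) ≋-refl (E w *P Y) w ⟩
      E w *P Y                     ∎
    y∂y-wY : yP *P ∂ fzero (w *P Y) ≋ natP n *P (w *P Y)
    y∂y-wY = begin
      yP *P ∂ fzero (w *P Y)                       ≈⟨ *P-congˡ yP (∂-leibniz fzero w Y) ⟩
      yP *P (∂ fzero w *P Y +P w *P ∂ fzero Y)
        ≈⟨ *P-congˡ yP (+P-congʳ (w *P ∂ fzero Y) (*P-congʳ Y (D-wF (∂-isDerivation fzero) ∂y-φ f))) ⟩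
      yP *P (zeroP *P Y +P w *P ∂ fzero Y)
        ≈⟨ solve 4 (λ y Y w ∂Y → y :* (con 0 :* Y :+ w :* ∂Y) := w :* (y :* ∂Y)) ≋-refl yP Y w (∂ fzero Y) ⟩
      w *P (yP *P ∂ fzero Y)                       ≈⟨ *P-congˡ w (varP-*P-∂-^P fzero n) ⟩
      w *P (natP n *P Y)                           ≈⟨ solve 3 (λ w N Y → w :* (N :* Y) := N :* (w :* Y)) ≋-refl w (natP n) Y ⟩
      natP n *P (w *P Y)                           ∎

  lahPoly-zero : lahPoly φ 0 ≋ oneP
  lahPoly-zero = solve 0 (con 1 :* con 1 :+ con 0 := con 1) ≋-refl

  lahPoly-suc : ∀ n → lahPoly φ (suc n) ≋ Ẽ (lahPoly φ n) +P yP *P lahPoly φ n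
  lahPoly-suc n = begin
    sumP (map weight (concatMap (insF (suc n)) (incForests n)))
      ≈⟨ sumP-concatMap weight (insF (suc n)) (incForests n) ⟩
    sumP (map (λ f → sumP (map weight (insF (suc n) f))) (incForests n))
      ≈⟨ sumP-cong (incForests n) (insF-weight (suc n)) ⟩
    sumP (map (λ f → Ẽ (weight f) +P yP *P weight f) (incForests n))
      ≈⟨ sumP-+ (Ẽ ∘ weight) (λ f → yP *P weight f) (incForests n) ⟩
    sumP (map (Ẽ ∘ weight) (incForests n)) +P sumP (map (λ f → yP *P weight f) (incForests n))
      ≈⟨ +P-cong (D-sumP Ẽ-isDerivation weight (incForests n)) (≋-sym (sumP-*ˡ yP weight (incForests n))) ⟨
    Ẽ (lahPoly φ n) +P yP *P lahPoly φ n ∎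

proposition4p4 : (r : ℕ) → 1 ≤ r → (n : ℕ) → lahPoly (hP r) n ≈P opPow r n
proposition4p4 r _ n = ≋⇒≈P (lahPoly≋opPow n)
  where
  open LahRecurrence (hP r) (sumX r) (Dminus-isDerivation r) (hP-zero r) (Dminus-hP r) (∂y-hP r) (Dminus-y r)
  lahPoly≋opPow : ∀ n → lahPoly (hP r) n ≋ opPow r n
  lahPoly≋opPow zero    = lahPoly-zero
  lahPoly≋opPow (suc n) = ≋-trans (lahPoly-suc n)
    (+P-cong (D-cong Ẽ-isDerivation (lahPoly≋opPow n)) (*P-congˡ yP (lahPoly≋opPow n)))
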